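{- Let $M$ be a matroid without loops and coloops on ground set $E$, let $P$ be a condensation of $\mathcal Z(M)$ with a system of representatives $\{R_B\}_{B\in P}$, and let $C_P(B,C)$, $F_P(B,C)$ be defined (for $B\le_P C$) by the recursion below. Let $1_P=\{E\}$ and $0_P=\{\emptyset\}$ (these are blocks of $P$). Then $$R_M(x,y)=\sum_{B\in P}C_P(B,1_P)\,F_P(0_P,B),$$ where $R_M(x,y)=\sum_{X\subseteq E}x^{r_M(E)-r_M(X)}y^{|X|-r_M(X)}$ is the rank generating polynomial.
   Context: A flat $X$ is cyclic if $M|X$ has no coloops; $\mathcal Z(M)$ is the set of cyclic flats. A partition $P$ of $\mathcal Z(M)$ is a condensation if for all $B,C\in P$: cardinality and rank are constant on $B$, and $A_P(B,C):=|\{X\in B: X\subseteq Y\}|$ is independent of $Y\in C$; set $B\le_P C$ iff $A_P(B,C)>0$. The $\mathbb Z$-linear maps $\delta_x:\mathbb Z[x,y]\to\mathbb Z[x]$, $\delta_y:\mathbb Z[x,y]\to\mathbb Z[y]$: if $f(x,x^{ -1})=\sum_i a_ix^i$ then $\delta_x(f)=\sum_{i\ge1}a_ix^i$; if $f(y^{ -1},y)=\sum_ib_iy^i$ then $\delta_y(f)=\sum_{i\ge0}b_iy^i$. For $r<n$: $b^x_{n,r}=\sum_{0\le i<r}\binom ni x^{r-i}$, $b^y_{n,r}=\sum_{r\le i\le n}\binom ni y^{i-r}$; $b^x_{0,0}=b^y_{0,0}=1$. For $B\le_P C$ define recursively $C_P(B,C)=A_P(B,C)b^x_{n,r}-\delta_x(S(B,C))$,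 $F_P(B,C)=A_P(B,C)b^y_{n,r}-\delta_y(S(B,C))$, $S(B,C)=\sum_D C_P(D,C)F_P(B,D)$ with $D$ over $\{D\in P:B\le_PD\le_PC\}\setminus\{B,C\}$, $n=|R_C|-|R_B|$, $r=r_M(R_C)-r_M(R_B)$. -}

module Defs where

open import Data.Bool using (Bool; true; false; _∧_; not)
open import Data.Nat as ℕ using (ℕ; zero; suc; _∸_; _<_; _≤_; _<ᵇ_; _≤ᵇ_)
open import Data.Nat.Combinatorics using (_C_)
open import Data.Integer as ℤ using (ℤ; +_; -_)
open import Data.Fin using (Fin; _≟_)
open import Data.Fin.Subset as S using (Subset; _∈_; _∉_; _⊆_; _∪_; _∩_; ⁅_⁆; _-_; ∣_∣)
open import Data.Fin.Subset.Properties using (_⊆?_)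
open import Data.List as L using (List; []; _∷_; _++_; map; concatMap; upTo; length; filterᵇ; allFin)
open import Data.List.Membership.Propositional as LM using ()
open import Data.Vec using ([]; _∷_)
open import Data.Product using (Σ; _×_; _,_; ∃)
open import Relation.Binary.PropositionalEquality using (_≡_; _≢_)
open import Relation.Nullary using (¬_)
open import Relation.Nullary.Decidable using (⌊_⌋)

record Matroid (n : ℕ) : Set where
  field
    rank    : Subset n → ℕ
    r-card  : ∀ X → rank X ≤ ∣ X ∣
    r-mono  : ∀ {X Y} → X ⊆ Y → rank X ≤ rank Y
    r-submod : ∀ X Y → rank (X ∪ Y) ℕ.+ rank (X ∩ Y) ≤ rank X ℕ.+ rank Y

module _ {n : ℕ} (M : Matroid n) where
  open Matroid M

  Loopless : Set
  Loopless = ∀ (e : Fin n) → rank ⁅ e ⁆ ≢ 0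

  Coloopless : Set
  Coloopless = ∀ (e : Fin n) → ¬ (rank (S.⊤ - e) < rank S.⊤)

  Flat : Subset n → Set
  Flat X = ∀ (e : Fin n) → rank (X ∪ ⁅ e ⁆) ≡ rank X → e ∈ X

  Cyclic : Subset n → Set
  Cyclic X = ∀ (e : Fin n) → e ∈ X → ¬ (rank (X - e) < rank X)

  CyclicFlat : Subset n → Set
  CyclicFlat X = Flat X × Cyclic X

  countBelow : List (Subset n) → Subset n → ℕ
  countBelow Bs Y = length (filterᵇ (λ X → ⌊ X ⊆? Y ⌋) Bs)

  record Condensation : Set where
    field
      k        : ℕ
      block    : Fin k → List (Subset n)
      nonempty : ∀ B → block B ≢ []
      sound    : ∀ B X → X LM.∈ block B → CyclicFlat X
      complete : ∀ X → CyclicFlat X → ∃ λ B → X LM.∈ block B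
      disjoint : ∀ B C X → X LM.∈ block B → X LM.∈ block C → B ≡ C
      nodup    : ∀ B → ∀ {i j : Fin (length (block B))} →
                 L.lookup (block B) i ≡ L.lookup (block B) j → i ≡ j
      const-card : ∀ B X Y → X LM.∈ block B → Y LM.∈ block B → ∣ X ∣ ≡ ∣ Y ∣
      const-rank : ∀ B X Y → X LM.∈ block B → Y LM.∈ block B → rank X ≡ rank Y
      const-A  : ∀ B C Y Y' → Y LM.∈ block C → Y' LM.∈ block C →
                 countBelow (block B) Y ≡ countBelow (block B) Y'

  record Representatives (P : Condensation) : Set where
    open Condensation P
    field
      R    : Fin k → Subset n
      R∈   : ∀ B → R B LM.∈ block B

-- Polynomials in ℤ[x,y] as formal finite sums of monomials c·x^i·y^j

Poly : Set
Poly = List (ℤ × ℕ × ℕ)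

0ₚ : Poly
0ₚ = []

1ₚ : Poly
1ₚ = (+ 1 , 0 , 0) ∷ []

_⊕_ : Poly → Poly → Poly
_⊕_ = _++_

⊖_ : Poly → Poly
⊖ p = map (λ { (c , i , j) → (- c , i , j) }) p

_⊗_ : Poly → Poly → Poly
p ⊗ q = concatMap (λ { (c , i , j) → map (λ { (d , a , b) → (c ℤ.* d , i ℕ.+ a , j ℕ.+ b) }) q }) p

_·ₚ_ : ℕ → Poly → Poly
a ·ₚ p = map (λ { (c , i , j) → (+ a ℤ.* c , i , j) }) p

Σₚ : List Poly → Poly
Σₚ = L.foldr _⊕_ 0ₚ

coeff : Poly → ℕ → ℕ → ℤ
coeff [] i j = + 0
coeff ((c , a , b) ∷ p) i j with a ℕ.≟ i | b ℕ.≟ j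
... | Relation.Nullary.yes _ | Relation.Nullary.yes _ = c ℤ.+ coeff p i j
... | _ | _ = coeff p i j

-- δ_x : substitute y = x⁻¹, keep the terms x^m with m ≥ 1 (linear, termwise)
δx : Poly → Poly
δx = concatMap (λ { (c , i , j) → if j <ᵇ i then (c , i ∸ j , 0) ∷ [] else [] })
  where open import Data.Bool using (if_then_else_)

-- δ_y : substitute x = y⁻¹, keep the terms y^m with m ≥ 0 (linear, termwise)
δy : Poly → Poly
δy = concatMap (λ { (c , i , j) → if i ≤ᵇ j then (c , 0 , j ∸ i) ∷ [] else [] })
  where open import Data.Bool using (if_then_else_)

bx : ℕ → ℕ → Poly
bx zero zero = 1ₚ
bx m r = map (λ i → (+ (m C i) , r ∸ i , 0)) (upTo r)

by : ℕ → ℕ → Poly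
by zero zero = 1ₚ
by m r = map (λ t → (+ (m C (r ℕ.+ t)) , 0 , t)) (upTo (suc m ∸ r))

allSubsets : (n : ℕ) → List (Subset n)
allSubsets zero = [] ∷ []
allSubsets (suc n) = map (false ∷_) (allSubsets n) ++ map (true ∷_) (allSubsets n)

module _ {n : ℕ} (M : Matroid n) where
  open Matroid M

  rankGenPoly : Poly
  rankGenPoly = map (λ X → (+ 1 , rank S.⊤ ∸ rank X , ∣ X ∣ ∸ rank X)) (allSubsets n)

  module _ (P : Condensation M) (Rep : Representatives M P) where
    open Condensation P
    open Representatives Rep

    A : Fin k → Fin k → ℕ
    A B C = countBelow M (block B) (R C)

    leqᵇ : Fin k → Fin k → Bool
    leqᵇ B C = 0 <ᵇ A B C

    nn rr : Fin k → Fin k → ℕ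
    nn B C = ∣ R C ∣ ∸ ∣ R B ∣
    rr B C = rank (R C) ∸ rank (R B)

    between : Fin k → Fin k → List (Fin k)
    between B C = filterᵇ (λ D → leqᵇ B D ∧ leqᵇ D C ∧ not ⌊ D ≟ B ⌋ ∧ not ⌊ D ≟ C ⌋) (allFin k)

    mutual
      CPf : ℕ → Fin k → Fin k → Poly
      CPf zero B C = 0ₚ
      CPf (suc f) B C = (A B C ·ₚ bx (nn B C) (rr B C)) ⊕ (⊖ δx (Sf f B C))

      FPf : ℕ → Fin k → Fin k → Poly
      FPf zero B C = 0ₚ
      FPf (suc f) B C = (A B C ·ₚ by (nn B C) (rr B C)) ⊕ (⊖ δy (Sf f B C))

      Sf : ℕ → Fin k → Fin k → Poly
      Sf f B C = Σₚ (map (λ D → CPf f D C ⊗ FPf f B D) (between B C))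

    -- fuel 1 + |E| suffices: every recursive call strictly decreases |R_C| - |R_B|
    CP FP : Fin k → Fin k → Poly
    CP = CPf (suc n)
    FP = FPf (suc n)

-- For X ⊆ Y let R(X, Y) = Σ_{X ⊆ S ⊆ Y} x^(r Y - r S) y^((∣S∣ - ∣X∣) - (r S - r X)), so that R_M = R(∅, E).
-- For X cyclic and Y flat, sorting the S by the cyclic flat W = cyc (cl S) factors
-- R(X, Y) = Σ_W C(W, Y) F(X, W): such an S is uniquely T ∪ J with T ⊆ W spanning W and J ⊆ Y ─ W
-- with cyc (cl (W ∪ J)) = W, and C collects the powers of x coming from J, F those of y coming from T.
-- Summing over blocks, with C_D(Y) = Σ_{W ∈ D} C(W, Y) and F_B(W) = Σ_{X ∈ B} F(X, W), one gets for Y ∈ C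
--   Σ_{X ∈ B} R(X, Y) = C_B(Y) + F_B(Y) + Σ_{B < D < C} C_D(Y) F_B(D).
-- δx and δy only see ∣S∣ - ∣X∣ in the terms of R(X, Y), so counting the S by size turns the left side into
-- A_P(B, C) b^x_{n,r}, resp. A_P(B, C) b^y_{n,r}; δx fixes C_B and kills F_B, and δy does the opposite.
-- Hence C_B(Y) = C_P(B, C) and F_B(Y) = F_P(B, C) by induction on ∣R_C∣ - ∣R_B∣, and X = ∅, Y = E gives the theorem.

module Submission where

open import Data.Nat using (ℕ)
open import Defs using (Matroid; Flat; Cyclic; CyclicFlat; Condensation; Representatives)

module ListSums where

  open import Data.Bool using (Bool; true; false; if_then_else_; _∧_)
  open import Data.Nat using (_<_; s≤s; z≤n)
  open import Data.Integer using (ℤ; +_) renaming (_+_ to _+ℤ_; _*_ to _*ℤ_)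
  import Data.Integer.Properties as ℤₚ
  open import Data.Integer.Tactic.RingSolver using (solve-∀)
  open import Data.Fin as Fin using (Fin; _≟_)
  import Data.Fin.Properties as Finₚ
  open import Data.List using (List; []; _∷_; _++_; map; filterᵇ; length; lookup; allFin)
  open import Data.List.Membership.Propositional using (_∈_)
  open import Data.List.Membership.Propositional.Properties using (∈-allFin)
  import Data.List.Relation.Unary.All as All
  open import Data.List.Relation.Unary.Any using (here; there; index)
  open import Data.List.Relation.Unary.Any.Properties using (lookup-index)
  open import Data.List.Relation.Unary.Unique.Propositional using (Unique; []; _∷_)
  open import Data.List.Relation.Unary.Unique.Propositional.Properties using (allFin⁺)
  open import Data.Product using (Σ; _×_; _,_)
  open import Relation.Binary.PropositionalEquality
  open import Relation.Nullary using (¬_; Dec; yes; no; does; contradiction)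
  open import Relation.Nullary.Decidable using (dec-true; dec-false)

  module _ {A : Set} where

    ∑ : List A → (A → ℤ) → ℤ
    ∑ [] f = + 0
    ∑ (x ∷ xs) f = f x +ℤ ∑ xs f

    ∑-++ : (xs ys : List A) (f : A → ℤ) → ∑ (xs ++ ys) f ≡ ∑ xs f +ℤ ∑ ys f
    ∑-++ [] ys f = sym (ℤₚ.+-identityˡ _)
    ∑-++ (x ∷ xs) ys f = trans (cong (f x +ℤ_) (∑-++ xs ys f)) (sym (ℤₚ.+-assoc (f x) _ _))

    ∑-cong-∈ : (xs : List A) {f g : A → ℤ} → (∀ x → x ∈ xs → f x ≡ g x) → ∑ xs f ≡ ∑ xs g
    ∑-cong-∈ [] e = refl
    ∑-cong-∈ (x ∷ xs) e = cong₂ _+ℤ_ (e x (here refl)) (∑-cong-∈ xs (λ y y∈ → e y (there y∈)))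

    ∑-cong : (xs : List A) {f g : A → ℤ} → (∀ x → f x ≡ g x) → ∑ xs f ≡ ∑ xs g
    ∑-cong xs e = ∑-cong-∈ xs (λ x _ → e x)

    ∑-zero : (xs : List A) → ∑ xs (λ _ → + 0) ≡ + 0
    ∑-zero [] = refl
    ∑-zero (x ∷ xs) = trans (ℤₚ.+-identityˡ _) (∑-zero xs)

    ∑-zero-∈ : (xs : List A) {f : A → ℤ} → (∀ x → x ∈ xs → f x ≡ + 0) → ∑ xs f ≡ + 0
    ∑-zero-∈ xs e = trans (∑-cong-∈ xs e) (∑-zero xs)

    ∑-+ : (xs : List A) (f g : A → ℤ) → ∑ xs (λ x → f x +ℤ g x) ≡ ∑ xs f +ℤ ∑ xs g
    ∑-+ [] f g = refl
    ∑-+ (x ∷ xs) f g = trans (cong (f x +ℤ g x +ℤ_) (∑-+ xs f g)) (interchange (f x) (g x) _ _)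
      where
      interchange : ∀ a b c d → a +ℤ b +ℤ (c +ℤ d) ≡ a +ℤ c +ℤ (b +ℤ d)
      interchange = solve-∀

    ∑-*ˡ : (xs : List A) (c : ℤ) (f : A → ℤ) → ∑ xs (λ x → c *ℤ f x) ≡ c *ℤ ∑ xs f
    ∑-*ˡ [] c f = sym (ℤₚ.*-zeroʳ c)
    ∑-*ˡ (x ∷ xs) c f = trans (cong (c *ℤ f x +ℤ_) (∑-*ˡ xs c f)) (sym (ℤₚ.*-distribˡ-+ c (f x) _))

    ∑-*ʳ : (xs : List A) (f : A → ℤ) (c : ℤ) → ∑ xs (λ x → f x *ℤ c) ≡ ∑ xs f *ℤ c
    ∑-*ʳ xs f c = trans (∑-cong xs (λ x → ℤₚ.*-comm (f x) c)) (trans (∑-*ˡ xs c f) (ℤₚ.*-comm c (∑ xs f)))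

    ∑-filterᵇ : (p : A → Bool) (xs : List A) (f : A → ℤ) →
                ∑ (filterᵇ p xs) f ≡ ∑ xs (λ x → if p x then f x else + 0)
    ∑-filterᵇ p [] f = refl
    ∑-filterᵇ p (x ∷ xs) f with p x
    ... | true = cong (f x +ℤ_) (∑-filterᵇ p xs f)
    ... | false = trans (∑-filterᵇ p xs f) (sym (ℤₚ.+-identityˡ _))

    ∑-if : (b : Bool) (xs : List A) (f : A → ℤ) →
           ∑ xs (λ x → if b then f x else + 0) ≡ (if b then ∑ xs f else + 0)
    ∑-if true xs f = refl
    ∑-if false xs f = ∑-zero xs

    length-filterᵇ : (p : A → Bool) (xs : List A) →
                     + length (filterᵇ p xs) ≡ ∑ xs (λ x → if p x then + 1 else + 0)
    length-filterᵇ p [] = refl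
    length-filterᵇ p (x ∷ xs) with p x
    ... | true = cong (+ 1 +ℤ_) (length-filterᵇ p xs)
    ... | false = trans (length-filterᵇ p xs) (sym (ℤₚ.+-identityˡ _))

    filterᵇ-nonempty⁻ : (p : A → Bool) (xs : List A) → 0 < length (filterᵇ p xs) →
                        Σ A (λ x → x ∈ xs × p x ≡ true)
    filterᵇ-nonempty⁻ p (x ∷ xs) pos with p x in px
    ... | true = x , here refl , px
    ... | false with filterᵇ-nonempty⁻ p xs pos
    ...   | y , y∈ , py = y , there y∈ , py

    filterᵇ-nonempty⁺ : (p : A → Bool) {xs : List A} {x : A} → x ∈ xs → p x ≡ true →
                        0 < length (filterᵇ p xs)
    filterᵇ-nonempty⁺ p {y ∷ xs} (here refl) py rewrite py = s≤s z≤n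
    filterᵇ-nonempty⁺ p {y ∷ xs} (there x∈) px with p y
    ... | true = s≤s z≤n
    ... | false = filterᵇ-nonempty⁺ p x∈ px

    ∑-unique : {xs : List A} (f : A → ℤ) {y : A} → Unique xs → y ∈ xs →
               (∀ x → x ∈ xs → x ≢ y → f x ≡ + 0) → ∑ xs f ≡ f y
    ∑-unique f (y∉ ∷ _) (here refl) others =
      trans (cong (f _ +ℤ_) (∑-zero-∈ _ (λ x x∈ → others x (there x∈) (λ { refl → All.lookup y∉ x∈ refl }))))
            (ℤₚ.+-identityʳ _)
    ∑-unique f (x≢ ∷ unique) (there y∈) others =
      trans (cong₂ _+ℤ_ (others _ (here refl) (λ { refl → All.lookup x≢ y∈ refl }))
                        (∑-unique f unique y∈ (λ x x∈ → others x (there x∈))))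
            (ℤₚ.+-identityˡ _)

  if-∧ : ∀ a b (x : ℤ) → (if a then (if b then x else + 0) else + 0) ≡ (if a ∧ b then x else + 0)
  if-∧ true b x = refl
  if-∧ false b x = refl

  module _ {P : Set} (P? : Dec P) {x y : ℤ} where

    if-yes : P → (if does P? then x else y) ≡ x
    if-yes p rewrite dec-true P? p = refl

    if-no : ¬ P → (if does P? then x else y) ≡ y
    if-no ¬p rewrite dec-false P? ¬p = refl

  does⇒ : {P : Set} (P? : Dec P) → does P? ≡ true → P
  does⇒ (yes p) _ = p

  if-does-zero : {P : Set} (P? : Dec P) {x : ℤ} → (P → x ≡ + 0) → (if does P? then x else + 0) ≡ + 0
  if-does-zero (yes p) x≡0 = x≡0 p
  if-does-zero (no _) _ = refl

  if-does-cong : {P Q : Set} (P? : Dec P) (Q? : Dec Q) {x y : ℤ} → (P → Q) → (Q → P) → (P → x ≡ y) →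
                 (if does P? then x else + 0) ≡ (if does Q? then y else + 0)
  if-does-cong (yes p) (yes q) _ _ x≡y = x≡y p
  if-does-cong (yes p) (no ¬q) P→Q _ _ = contradiction (P→Q p) ¬q
  if-does-cong (no ¬p) (yes q) _ Q→P _ = contradiction (Q→P q) ¬p
  if-does-cong (no _) (no _) _ _ _ = refl

  lookup-injective⇒Unique : {A : Set} (xs : List A) → (∀ {i j} → lookup xs i ≡ lookup xs j → i ≡ j) → Unique xs
  lookup-injective⇒Unique [] _ = []
  lookup-injective⇒Unique (x ∷ xs) inj =
    All.tabulate (λ {y} y∈ x≡y → Finₚ.0≢1+n (inj {Fin.zero} {Fin.suc (index y∈)} (trans x≡y (lookup-index y∈))))
    ∷ lookup-injective⇒Unique xs (λ eq → Finₚ.suc-injective (inj eq))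

  ∑-allFin-≟ : ∀ {k} (B : Fin k) (x : ℤ) → ∑ (allFin k) (λ D → if does (D ≟ B) then x else + 0) ≡ x
  ∑-allFin-≟ {k} B x = trans (∑-unique _ (allFin⁺ k) (∈-allFin B) (λ D _ D≢B → if-no (D ≟ B) D≢B)) (if-yes (B ≟ B) refl)

  module _ {A B : Set} where

    ∑-map : (g : A → B) (xs : List A) (f : B → ℤ) → ∑ (map g xs) f ≡ ∑ xs (λ x → f (g x))
    ∑-map g [] f = refl
    ∑-map g (x ∷ xs) f = cong (f (g x) +ℤ_) (∑-map g xs f)

    ∑-comm : (xs : List A) (ys : List B) (f : A → B → ℤ) →
             ∑ xs (λ x → ∑ ys (f x)) ≡ ∑ ys (λ y → ∑ xs (λ x → f x y))
    ∑-comm [] ys f = sym (∑-zero ys)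
    ∑-comm (x ∷ xs) ys f =
      trans (cong (∑ ys (f x) +ℤ_) (∑-comm xs ys f)) (sym (∑-+ ys (f x) (λ y → ∑ xs (λ x' → f x' y))))

module Polynomials where

  open import Defs using (Poly; 0ₚ; 1ₚ; ⊖_; _⊗_; _·ₚ_; Σₚ; coeff; δx; δy; bx; by)
  open ListSums
  open import Data.Bool using (Bool; true; false; if_then_else_)
  open import Data.Nat using (ℕ; zero; suc; _+_; _∸_; _<_; _≤_; _⊔_; _<ᵇ_; _≤ᵇ_; _≟_)
  import Data.Nat.Properties as ℕₚ
  open import Data.Nat.Combinatorics using (_C_)
  open import Data.Integer using (ℤ; +_; -_) renaming (_+_ to _+ℤ_; _*_ to _*ℤ_)
  import Data.Integer.Properties as ℤₚ
  open import Data.Integer.Tactic.RingSolver using (solve-∀)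
  open import Data.List using (List; []; _∷_; _++_; map; upTo; filterᵇ)
  open import Data.List.Membership.Propositional.Properties using (∈-upTo⁺; ∈-upTo⁻)
  open import Data.List.Relation.Unary.Unique.Propositional.Properties using (upTo⁺)
  open import Data.Product using (_×_; _,_)
  open import Data.Empty using (⊥-elim)
  open import Relation.Binary.PropositionalEquality
  open import Relation.Nullary using (yes; no)

  kron : ℕ → ℕ → ℤ
  kron a i with a ≟ i
  ... | yes _ = + 1
  ... | no _ = + 0

  kron-refl : ∀ a → kron a a ≡ + 1
  kron-refl a with a ≟ a
  ... | yes _ = refl
  ... | no a≢a = ⊥-elim (a≢a refl)

  kron-≢ : ∀ {a i} → a ≢ i → kron a i ≡ + 0
  kron-≢ {a} {i} a≢i with a ≟ i
  ... | yes a≡i = ⊥-elim (a≢i a≡i)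
  ... | no _ = refl

  kron-suc : ∀ a b → kron (suc a) (suc b) ≡ kron a b
  kron-suc a b with a ≟ b
  ... | yes refl = kron-refl (suc a)
  ... | no a≢b = kron-≢ (λ sa≡sb → a≢b (ℕₚ.suc-injective sa≡sb))

  ∑-kron : ∀ N a (f : ℕ → ℤ) → a < N → ∑ (upTo N) (λ b → kron a b *ℤ f b) ≡ f a
  ∑-kron N a f a<N =
    trans (∑-unique (λ b → kron a b *ℤ f b) (upTo⁺ N) (∈-upTo⁺ a<N)
                    (λ b _ b≢a → cong (_*ℤ f b) (kron-≢ (λ a≡b → b≢a (sym a≡b)))))
          (trans (cong (_*ℤ f a) (kron-refl a)) (ℤₚ.*-identityˡ (f a)))

  monoCoeff : ℕ → ℕ → ℕ → ℕ → ℤ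
  monoCoeff a b i j = kron a i *ℤ kron b j

  linExt : (ℕ → ℕ → ℤ) → Poly → ℤ
  linExt h p = ∑ p (λ (c , a , b) → c *ℤ h a b)

  coeff-∷ : ∀ c a b p i j → coeff ((c , a , b) ∷ p) i j ≡ c *ℤ monoCoeff a b i j +ℤ coeff p i j
  coeff-∷ c a b p i j with a ≟ i | b ≟ j
  ... | yes refl | yes refl = cong (_+ℤ coeff p a b) (sym (ℤₚ.*-identityʳ c))
  ... | yes refl | no _ = sym (trans (cong (_+ℤ coeff p a j) (ℤₚ.*-zeroʳ c)) (ℤₚ.+-identityˡ _))
  ... | no _ | _ = sym (trans (cong (_+ℤ coeff p i j) (ℤₚ.*-zeroʳ c)) (ℤₚ.+-identityˡ _))

  coeff-linExt : ∀ p i j → coeff p i j ≡ linExt (λ a b → monoCoeff a b i j) p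
  coeff-linExt [] i j = refl
  coeff-linExt ((c , a , b) ∷ p) i j = trans (coeff-∷ c a b p i j) (cong (c *ℤ monoCoeff a b i j +ℤ_) (coeff-linExt p i j))

  infix 4 _≈_
  _≈_ : Poly → Poly → Set
  p ≈ q = ∀ i j → coeff p i j ≡ coeff q i j
  ≈-sym : ∀ {p q} → p ≈ q → q ≈ p
  ≈-sym p≈q i j = sym (p≈q i j)

  coeff-++ : ∀ p q i j → coeff (p ++ q) i j ≡ coeff p i j +ℤ coeff q i j
  coeff-++ p q i j = begin
    coeff (p ++ q) i j                  ≡⟨ coeff-linExt (p ++ q) i j ⟩
    linExt _ (p ++ q)                   ≡⟨ ∑-++ p q _ ⟩
    linExt _ p +ℤ linExt _ q            ≡⟨ sym (cong₂ _+ℤ_ (coeff-linExt p i j) (coeff-linExt q i j)) ⟩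
    coeff p i j +ℤ coeff q i j          ∎
    where open ≡-Reasoning

  coeff-Σₚ : {A : Set} (f : A → Poly) (xs : List A) (i j : ℕ) →
             coeff (Σₚ (map f xs)) i j ≡ ∑ xs (λ x → coeff (f x) i j)
  coeff-Σₚ f [] i j = refl
  coeff-Σₚ f (x ∷ xs) i j = trans (coeff-++ (f x) _ i j) (cong (coeff (f x) i j +ℤ_) (coeff-Σₚ f xs i j))

  coeff-⊖ : ∀ p i j → coeff (⊖ p) i j ≡ - coeff p i j
  coeff-⊖ [] i j = refl
  coeff-⊖ ((c , a , b) ∷ p) i j = begin
    coeff (⊖ ((c , a , b) ∷ p)) i j                 ≡⟨ coeff-∷ (- c) a b (⊖ p) i j ⟩
    - c *ℤ monoCoeff a b i j +ℤ coeff (⊖ p) i j      ≡⟨ cong₂ _+ℤ_ (sym (ℤₚ.neg-distribˡ-* c _)) (coeff-⊖ p i j) ⟩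
    - (c *ℤ monoCoeff a b i j) +ℤ - coeff p i j      ≡⟨ sym (ℤₚ.neg-distrib-+ (c *ℤ monoCoeff a b i j) _) ⟩
    - (c *ℤ monoCoeff a b i j +ℤ coeff p i j)        ≡⟨ cong -_ (sym (coeff-∷ c a b p i j)) ⟩
    - coeff ((c , a , b) ∷ p) i j                    ∎
    where open ≡-Reasoning

  coeff-·ₚ : ∀ k p i j → coeff (k ·ₚ p) i j ≡ + k *ℤ coeff p i j
  coeff-·ₚ k [] i j = sym (ℤₚ.*-zeroʳ (+ k))
  coeff-·ₚ k ((c , a , b) ∷ p) i j = begin
    coeff (k ·ₚ ((c , a , b) ∷ p)) i j                        ≡⟨ coeff-∷ (+ k *ℤ c) a b (k ·ₚ p) i j ⟩
    + k *ℤ c *ℤ monoCoeff a b i j +ℤ coeff (k ·ₚ p) i j        ≡⟨ cong (+ k *ℤ c *ℤ monoCoeff a b i j +ℤ_) (coeff-·ₚ k p i j) ⟩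
    + k *ℤ c *ℤ monoCoeff a b i j +ℤ + k *ℤ coeff p i j        ≡⟨ distrib (+ k) c _ _ ⟩
    + k *ℤ (c *ℤ monoCoeff a b i j +ℤ coeff p i j)            ≡⟨ cong (+ k *ℤ_) (sym (coeff-∷ c a b p i j)) ⟩
    + k *ℤ coeff ((c , a , b) ∷ p) i j                        ∎
    where
    open ≡-Reasoning
    distrib : ∀ k c m r → k *ℤ c *ℤ m +ℤ k *ℤ r ≡ k *ℤ (c *ℤ m +ℤ r)
    distrib = solve-∀

  coeff-1ₚ : ∀ i j → coeff 1ₚ i j ≡ monoCoeff 0 0 i j
  coeff-1ₚ i j = trans (coeff-∷ (+ 1) 0 0 [] i j) (trans (ℤₚ.+-identityʳ _) (ℤₚ.*-identityˡ _))

  ∑² : ℕ → (ℕ → ℕ → ℤ) → ℤ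
  ∑² N g = ∑ (upTo N) (λ a → ∑ (upTo N) (λ b → g a b))

  ∑²-+ : ∀ N (f g : ℕ → ℕ → ℤ) → ∑² N (λ a b → f a b +ℤ g a b) ≡ ∑² N f +ℤ ∑² N g
  ∑²-+ N f g = trans (∑-cong (upTo N) (λ a → ∑-+ (upTo N) (f a) (g a))) (∑-+ (upTo N) _ _)

  degBound : Poly → ℕ
  degBound [] = 0
  degBound ((c , a , b) ∷ p) = suc a ⊔ suc b ⊔ degBound p

  linExt-expand : ∀ h p N → degBound p ≤ N → linExt h p ≡ ∑² N (λ a b → coeff p a b *ℤ h a b)
  linExt-expand h [] N _ = sym (trans (∑-cong (upTo N) (λ a → ∑-zero (upTo N))) (∑-zero (upTo N)))
  linExt-expand h ((c , a , b) ∷ p) N bound = begin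
    c *ℤ h a b +ℤ linExt h p
      ≡⟨ cong₂ _+ℤ_ (sym leading) (linExt-expand h p N (ℕₚ.m⊔n≤o⇒n≤o (suc a ⊔ suc b) (degBound p) bound)) ⟩
    ∑² N (λ a' b' → kron a a' *ℤ (kron b b' *ℤ (c *ℤ h a' b'))) +ℤ ∑² N (λ a' b' → coeff p a' b' *ℤ h a' b')
      ≡⟨ sym (∑²-+ N _ _) ⟩
    ∑² N (λ a' b' → kron a a' *ℤ (kron b b' *ℤ (c *ℤ h a' b')) +ℤ coeff p a' b' *ℤ h a' b')
      ≡⟨ ∑-cong (upTo N) (λ a' → ∑-cong (upTo N) (λ b' → regroup a' b')) ⟩
    ∑² N (λ a' b' → coeff ((c , a , b) ∷ p) a' b' *ℤ h a' b')
      ∎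
    where
    open ≡-Reasoning
    a<N : a < N
    a<N = ℕₚ.m⊔n≤o⇒m≤o (suc a) (suc b) (ℕₚ.m⊔n≤o⇒m≤o (suc a ⊔ suc b) (degBound p) bound)
    b<N : b < N
    b<N = ℕₚ.m⊔n≤o⇒n≤o (suc a) (suc b) (ℕₚ.m⊔n≤o⇒m≤o (suc a ⊔ suc b) (degBound p) bound)
    leading : ∑² N (λ a' b' → kron a a' *ℤ (kron b b' *ℤ (c *ℤ h a' b'))) ≡ c *ℤ h a b
    leading = trans (∑-cong (upTo N) (λ a' → ∑-*ˡ (upTo N) (kron a a') _))
                    (trans (∑-kron N a _ a<N) (∑-kron N b (λ b' → c *ℤ h a b') b<N))
    regroup : ∀ a' b' → kron a a' *ℤ (kron b b' *ℤ (c *ℤ h a' b')) +ℤ coeff p a' b' *ℤ h a' b'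
                      ≡ coeff ((c , a , b) ∷ p) a' b' *ℤ h a' b'
    regroup a' b' rewrite coeff-∷ c a b p a' b' = ring (kron a a') (kron b b') c (h a' b') (coeff p a' b')
      where
      ring : ∀ x y c z w → x *ℤ (y *ℤ (c *ℤ z)) +ℤ w *ℤ z ≡ (c *ℤ (x *ℤ y) +ℤ w) *ℤ z
      ring = solve-∀

  linExt-≈ : ∀ h {p q} → p ≈ q → linExt h p ≡ linExt h q
  linExt-≈ h {p} {q} p≈q = begin
    linExt h p                              ≡⟨ linExt-expand h p N (ℕₚ.m≤m⊔n _ _) ⟩
    ∑² N (λ a b → coeff p a b *ℤ h a b)     ≡⟨ ∑-cong (upTo N) (λ a → ∑-cong (upTo N) (λ b → cong (_*ℤ h a b) (p≈q a b))) ⟩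
    ∑² N (λ a b → coeff q a b *ℤ h a b)     ≡⟨ sym (linExt-expand h q N (ℕₚ.m≤n⊔m _ _)) ⟩
    linExt h q                              ∎
    where
    open ≡-Reasoning
    N = degBound p ⊔ degBound q

  linExt-Σₚ : {A : Set} (h : ℕ → ℕ → ℤ) (f : A → Poly) (xs : List A) →
              linExt h (Σₚ (map f xs)) ≡ ∑ xs (λ x → linExt h (f x))
  linExt-Σₚ h f [] = refl
  linExt-Σₚ h f (x ∷ xs) = trans (∑-++ (f x) _ _) (cong (linExt h (f x) +ℤ_) (linExt-Σₚ h f xs))

  linExt-∑ : {A : Set} (xs : List A) (g : A → ℕ → ℕ → ℤ) (p : Poly) →
             linExt (λ a b → ∑ xs (λ x → g x a b)) p ≡ ∑ xs (λ x → linExt (g x) p)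
  linExt-∑ xs g p = trans (∑-cong p (λ (c , a , b) → sym (∑-*ˡ xs c (λ x → g x a b))))
                          (∑-comm p xs (λ (c , a , b) x → c *ℤ g x a b))

  genPoly : {A : Set} → List A → (A → ℕ) → (A → ℕ) → Poly
  genPoly xs ex ey = map (λ x → (+ 1 , ex x , ey x)) xs

  linExt-genPoly : {A : Set} (h : ℕ → ℕ → ℤ) (xs : List A) (ex ey : A → ℕ) →
                   linExt h (genPoly xs ex ey) ≡ ∑ xs (λ x → h (ex x) (ey x))
  linExt-genPoly h xs ex ey = trans (∑-map _ xs _) (∑-cong xs (λ x → ℤₚ.*-identityˡ _))

  coeff-genPoly : {A : Set} (xs : List A) (ex ey : A → ℕ) (i j : ℕ) →
                  coeff (genPoly xs ex ey) i j ≡ ∑ xs (λ x → monoCoeff (ex x) (ey x) i j)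
  coeff-genPoly xs ex ey i j = trans (coeff-linExt (genPoly xs ex ey) i j) (linExt-genPoly _ xs ex ey)

  linExt-genPoly-filterᵇ : {A : Set} (h : ℕ → ℕ → ℤ) (p : A → Bool) (xs : List A) (ex ey : A → ℕ) →
                           linExt h (genPoly (filterᵇ p xs) ex ey) ≡ ∑ xs (λ x → if p x then h (ex x) (ey x) else + 0)
  linExt-genPoly-filterᵇ h p xs ex ey = trans (linExt-genPoly h (filterᵇ p xs) ex ey) (∑-filterᵇ p xs _)

  coeff-genPoly-filterᵇ : {A : Set} (p : A → Bool) (xs : List A) (ex ey : A → ℕ) (i j : ℕ) →
                          coeff (genPoly (filterᵇ p xs) ex ey) i j
                          ≡ ∑ xs (λ x → if p x then monoCoeff (ex x) (ey x) i j else + 0)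
  coeff-genPoly-filterᵇ p xs ex ey i j =
    trans (coeff-linExt (genPoly (filterᵇ p xs) ex ey) i j) (linExt-genPoly-filterᵇ _ p xs ex ey)

  -- the coefficient of x^i y^j in x^a y^b ⊗ q
  shiftedCoeff : Poly → ℕ → ℕ → ℕ → ℕ → ℤ
  shiftedCoeff q i j a b = linExt (λ a' b' → monoCoeff (a + a') (b + b') i j) q

  scaleShift : ℤ → ℕ → ℕ → ℤ × ℕ × ℕ → ℤ × ℕ × ℕ
  scaleShift c a b (d , a' , b') = (c *ℤ d , a + a' , b + b')

  coeff-⊗ : ∀ p q i j → coeff (p ⊗ q) i j ≡ linExt (shiftedCoeff q i j) p
  coeff-⊗ [] q i j = refl
  coeff-⊗ ((c , a , b) ∷ p) q i j =
    trans (coeff-++ (map (scaleShift c a b) q) (p ⊗ q) i j) (cong₂ _+ℤ_ scaled (coeff-⊗ p q i j))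
    where
    scaled : coeff (map (scaleShift c a b) q) i j ≡ c *ℤ shiftedCoeff q i j a b
    scaled = trans (coeff-linExt (map (scaleShift c a b) q) i j) (trans (∑-map (scaleShift c a b) q _)
      (trans (∑-cong q (λ (d , a' , b') → ℤₚ.*-assoc c d _)) (∑-*ˡ q c _)))

  ⊗-congˡ : ∀ {p p'} q → p ≈ p' → p ⊗ q ≈ p' ⊗ q
  ⊗-congˡ {p} {p'} q p≈p' i j =
    trans (coeff-⊗ p q i j) (trans (linExt-≈ (shiftedCoeff q i j) {p} {p'} p≈p') (sym (coeff-⊗ p' q i j)))

  ⊗-congʳ : ∀ p {q q'} → q ≈ q' → p ⊗ q ≈ p ⊗ q'
  ⊗-congʳ p {q} {q'} q≈q' i j = trans (coeff-⊗ p q i j) (trans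
    (∑-cong p (λ (c , a , b) → cong (c *ℤ_) (linExt-≈ (λ a' b' → monoCoeff (a + a') (b + b') i j) {q} {q'} q≈q')))
    (sym (coeff-⊗ p q' i j)))

  coeff-Σₚ-⊗ : {A : Set} (f : A → Poly) (xs : List A) (q : Poly) (i j : ℕ) →
               coeff (Σₚ (map f xs) ⊗ q) i j ≡ ∑ xs (λ x → coeff (f x ⊗ q) i j)
  coeff-Σₚ-⊗ f xs q i j = trans (coeff-⊗ (Σₚ (map f xs)) q i j)
    (trans (linExt-Σₚ (shiftedCoeff q i j) f xs) (∑-cong xs (λ x → sym (coeff-⊗ (f x) q i j))))

  coeff-⊗-Σₚ : {A : Set} (p : Poly) (f : A → Poly) (xs : List A) (i j : ℕ) →
               coeff (p ⊗ Σₚ (map f xs)) i j ≡ ∑ xs (λ x → coeff (p ⊗ f x) i j)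
  coeff-⊗-Σₚ p f xs i j = begin
    coeff (p ⊗ Σₚ (map f xs)) i j
      ≡⟨ coeff-⊗ p (Σₚ (map f xs)) i j ⟩
    linExt (shiftedCoeff (Σₚ (map f xs)) i j) p
      ≡⟨ ∑-cong p (λ (c , a , b) → cong (c *ℤ_) (linExt-Σₚ (λ a' b' → monoCoeff (a + a') (b + b') i j) f xs)) ⟩
    linExt (λ a b → ∑ xs (λ x → shiftedCoeff (f x) i j a b)) p
      ≡⟨ linExt-∑ xs (λ x → shiftedCoeff (f x) i j) p ⟩
    ∑ xs (λ x → linExt (shiftedCoeff (f x) i j) p)
      ≡⟨ ∑-cong xs (λ x → sym (coeff-⊗ p (f x) i j)) ⟩
    ∑ xs (λ x → coeff (p ⊗ f x) i j)
      ∎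
    where open ≡-Reasoning

  ⊗-0ₚ : ∀ p → p ⊗ 0ₚ ≈ 0ₚ
  ⊗-0ₚ p i j = coeff-⊗-Σₚ p (λ q → q) [] i j

  ⊗-1ₚ : ∀ p → p ⊗ 1ₚ ≈ p
  ⊗-1ₚ p i j = trans (coeff-⊗ p 1ₚ i j) (trans (∑-cong p unit) (sym (coeff-linExt p i j)))
    where
    unit : ∀ ((c , a , b) : ℤ × ℕ × ℕ) → c *ℤ shiftedCoeff 1ₚ i j a b ≡ c *ℤ monoCoeff a b i j
    unit (c , a , b) = cong (c *ℤ_) (trans (ℤₚ.+-identityʳ _) (trans (ℤₚ.*-identityˡ _)
      (cong₂ (λ a' b' → monoCoeff a' b' i j) (ℕₚ.+-identityʳ a) (ℕₚ.+-identityʳ b))))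

  1ₚ-⊗ : ∀ q → 1ₚ ⊗ q ≈ q
  1ₚ-⊗ q i j = trans (coeff-⊗ 1ₚ q i j)
    (trans (ℤₚ.+-identityʳ _) (trans (ℤₚ.*-identityˡ _) (sym (coeff-linExt q i j))))

  coeff-genPoly-⊗ : {A B : Set} (xs : List A) (ex ey : A → ℕ) (zs : List B) (fx fy : B → ℕ) (i j : ℕ) →
                    coeff (genPoly xs ex ey ⊗ genPoly zs fx fy) i j
                    ≡ ∑ xs (λ x → ∑ zs (λ z → monoCoeff (ex x + fx z) (ey x + fy z) i j))
  coeff-genPoly-⊗ xs ex ey zs fx fy i j =
    trans (coeff-⊗ (genPoly xs ex ey) _ i j)
          (trans (linExt-genPoly _ xs ex ey) (∑-cong xs (λ x → linExt-genPoly _ zs fx fy)))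

  ∑-upTo-kron : ∀ N u (g : ℕ → ℤ) → ∑ (upTo N) (λ t → kron t u *ℤ g t) ≡ (if u <ᵇ N then g u else + 0)
  ∑-upTo-kron N u g with u ℕₚ.<? N
  ... | yes u<N = begin
    ∑ (upTo N) (λ t → kron t u *ℤ g t)
      ≡⟨ ∑-unique (λ t → kron t u *ℤ g t) (upTo⁺ N) (∈-upTo⁺ u<N) (λ t _ t≢u → cong (_*ℤ g t) (kron-≢ t≢u)) ⟩
    kron u u *ℤ g u
      ≡⟨ trans (cong (_*ℤ g u) (kron-refl u)) (ℤₚ.*-identityˡ (g u)) ⟩
    g u
      ≡⟨ sym (if-yes (u ℕₚ.<? N) u<N) ⟩
    (if u <ᵇ N then g u else + 0)
      ∎
    where open ≡-Reasoning
  ... | no u≮N = trans (∑-zero-∈ (upTo N) (λ t t∈ → cong (_*ℤ g t) (kron-≢ (λ t≡u → u≮N (subst (_< N) t≡u (∈-upTo⁻ t∈))))))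
                       (sym (if-no (u ℕₚ.<? N) u≮N))

  ∑-upTo-kron-+ : ∀ R K u (g : ℕ → ℤ) → u < R + K →
                  ∑ (upTo K) (λ t → kron (R + t) u *ℤ g t) ≡ (if R ≤ᵇ u then g (u ∸ R) else + 0)
  ∑-upTo-kron-+ R K u g u<R+K with R ℕₚ.≤? u
  ... | yes R≤u = begin
    ∑ (upTo K) (λ t → kron (R + t) u *ℤ g t)
      ≡⟨ ∑-unique (λ t → kron (R + t) u *ℤ g t) (upTo⁺ K) (∈-upTo⁺ u∸R<K) (λ t _ t≢u∸R → cong (_*ℤ g t)
           (kron-≢ (λ R+t≡u → t≢u∸R (trans (sym (ℕₚ.m+n∸m≡n R t)) (cong (_∸ R) R+t≡u))))) ⟩
    kron (R + (u ∸ R)) u *ℤ g (u ∸ R)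
      ≡⟨ cong (λ v → kron v u *ℤ g (u ∸ R)) (ℕₚ.m+[n∸m]≡n R≤u) ⟩
    kron u u *ℤ g (u ∸ R)
      ≡⟨ trans (cong (_*ℤ g (u ∸ R)) (kron-refl u)) (ℤₚ.*-identityˡ _) ⟩
    g (u ∸ R)
      ≡⟨ sym (if-yes (R ℕₚ.≤? u) R≤u) ⟩
    (if R ≤ᵇ u then g (u ∸ R) else + 0)
      ∎
    where
    open ≡-Reasoning
    u∸R<K : u ∸ R < K
    u∸R<K = subst (u ∸ R <_) (ℕₚ.m+n∸m≡n R K) (ℕₚ.∸-monoˡ-< u<R+K R≤u)
  ... | no R≰u = trans
    (∑-zero-∈ (upTo K) (λ t _ → cong (_*ℤ g t) (kron-≢ (λ R+t≡u → R≰u (subst (R ≤_) R+t≡u (ℕₚ.m≤m+n R t))))))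
    (sym (if-no (R ℕₚ.≤? u) R≰u))

  truncX truncY : ℕ → ℕ → ℕ → ℕ → ℤ
  truncX i j a b = if b <ᵇ a then monoCoeff (a ∸ b) 0 i j else + 0
  truncY i j a b = if a ≤ᵇ b then monoCoeff 0 (b ∸ a) i j else + 0

  truncX-pos : ∀ i j {a} → 0 < a → truncX i j a 0 ≡ monoCoeff a 0 i j
  truncX-pos i j {suc a} _ = refl

  truncY-pos : ∀ i j {a} → 0 < a → truncY i j a 0 ≡ + 0
  truncY-pos i j {suc a} _ = refl

  truncX-+ : ∀ i j q a b → truncX i j (q + a) (q + b) ≡ truncX i j a b
  truncX-+ i j zero a b = refl
  truncX-+ i j (suc q) a b = truncX-+ i j q a b

  truncY-+ : ∀ i j q a b → truncY i j (q + a) (q + b) ≡ truncY i j a b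
  truncY-+ i j q a b = cong₂ (λ c e → if c then monoCoeff 0 e i j else + 0) (≤ᵇ-+ q) (ℕₚ.[m+n]∸[m+o]≡n∸o q b a)
    where
    <ᵇ-suc : ∀ m n → (m <ᵇ suc n) ≡ (m ≤ᵇ n)
    <ᵇ-suc zero n = refl
    <ᵇ-suc (suc m) n = refl
    ≤ᵇ-+ : ∀ q → (q + a ≤ᵇ q + b) ≡ (a ≤ᵇ b)
    ≤ᵇ-+ zero = refl
    ≤ᵇ-+ (suc q) = trans (<ᵇ-suc (q + a) (q + b)) (≤ᵇ-+ q)

  truncX-∸ : ∀ i j {q a b} → q ≤ a → q ≤ b → truncX i j (a ∸ q) (b ∸ q) ≡ truncX i j a b
  truncX-∸ i j {q} {a} {b} q≤a q≤b =
    trans (sym (truncX-+ i j q (a ∸ q) (b ∸ q))) (cong₂ (truncX i j) (ℕₚ.m+[n∸m]≡n q≤a) (ℕₚ.m+[n∸m]≡n q≤b))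

  truncY-∸ : ∀ i j {q a b} → q ≤ a → q ≤ b → truncY i j (a ∸ q) (b ∸ q) ≡ truncY i j a b
  truncY-∸ i j {q} {a} {b} q≤a q≤b =
    trans (sym (truncY-+ i j q (a ∸ q) (b ∸ q))) (cong₂ (truncY i j) (ℕₚ.m+[n∸m]≡n q≤a) (ℕₚ.m+[n∸m]≡n q≤b))

  coeff-δx : ∀ p i j → coeff (δx p) i j ≡ linExt (truncX i j) p
  coeff-δx [] i j = refl
  coeff-δx ((c , a , b) ∷ p) i j =
    trans (coeff-++ (if b <ᵇ a then (c , a ∸ b , 0) ∷ [] else []) (δx p) i j)
          (cong₂ _+ℤ_ leading (coeff-δx p i j))
    where
    leading : coeff (if b <ᵇ a then (c , a ∸ b , 0) ∷ [] else []) i j ≡ c *ℤ truncX i j a b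
    leading with b <ᵇ a
    ... | true = trans (coeff-∷ c (a ∸ b) 0 [] i j) (ℤₚ.+-identityʳ _)
    ... | false = sym (ℤₚ.*-zeroʳ c)

  coeff-δy : ∀ p i j → coeff (δy p) i j ≡ linExt (truncY i j) p
  coeff-δy [] i j = refl
  coeff-δy ((c , a , b) ∷ p) i j =
    trans (coeff-++ (if a ≤ᵇ b then (c , 0 , b ∸ a) ∷ [] else []) (δy p) i j)
          (cong₂ _+ℤ_ leading (coeff-δy p i j))
    where
    leading : coeff (if a ≤ᵇ b then (c , 0 , b ∸ a) ∷ [] else []) i j ≡ c *ℤ truncY i j a b
    leading with a ≤ᵇ b
    ... | true = trans (coeff-∷ c 0 (b ∸ a) [] i j) (ℤₚ.+-identityʳ _)
    ... | false = sym (ℤₚ.*-zeroʳ c)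

  δx-cong : ∀ {p q} → p ≈ q → δx p ≈ δx q
  δx-cong {p} {q} p≈q i j = trans (coeff-δx p i j) (trans (linExt-≈ (truncX i j) {p} {q} p≈q) (sym (coeff-δx q i j)))

  δy-cong : ∀ {p q} → p ≈ q → δy p ≈ δy q
  δy-cong {p} {q} p≈q i j = trans (coeff-δy p i j) (trans (linExt-≈ (truncY i j) {p} {q} p≈q) (sym (coeff-δy q i j)))

  coeff-δx-++ : ∀ p q i j → coeff (δx (p ++ q)) i j ≡ coeff (δx p) i j +ℤ coeff (δx q) i j
  coeff-δx-++ p q i j = trans (coeff-δx (p ++ q) i j)
    (trans (∑-++ p q _) (sym (cong₂ _+ℤ_ (coeff-δx p i j) (coeff-δx q i j))))

  coeff-δy-++ : ∀ p q i j → coeff (δy (p ++ q)) i j ≡ coeff (δy p) i j +ℤ coeff (δy q) i j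
  coeff-δy-++ p q i j = trans (coeff-δy (p ++ q) i j)
    (trans (∑-++ p q _) (sym (cong₂ _+ℤ_ (coeff-δy p i j) (coeff-δy q i j))))

  coeff-δx-Σₚ : {A : Set} (f : A → Poly) (xs : List A) (i j : ℕ) →
                coeff (δx (Σₚ (map f xs))) i j ≡ ∑ xs (λ x → coeff (δx (f x)) i j)
  coeff-δx-Σₚ f xs i j = trans (coeff-δx (Σₚ (map f xs)) i j)
    (trans (linExt-Σₚ (truncX i j) f xs) (∑-cong xs (λ x → sym (coeff-δx (f x) i j))))

  coeff-δy-Σₚ : {A : Set} (f : A → Poly) (xs : List A) (i j : ℕ) →
                coeff (δy (Σₚ (map f xs))) i j ≡ ∑ xs (λ x → coeff (δy (f x)) i j)
  coeff-δy-Σₚ f xs i j = trans (coeff-δy (Σₚ (map f xs)) i j)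
    (trans (linExt-Σₚ (truncY i j) f xs) (∑-cong xs (λ x → sym (coeff-δy (f x) i j))))

  coeff-bx : ∀ m R i j → 0 < m → coeff (bx m R) i j ≡ ∑ (upTo R) (λ t → + (m C t) *ℤ monoCoeff (R ∸ t) 0 i j)
  coeff-bx (suc m) R i j _ = trans (coeff-linExt (bx (suc m) R) i j) (∑-map _ (upTo R) _)

  coeff-by : ∀ m R i j → 0 < m →
             coeff (by m R) i j ≡ ∑ (upTo (suc m ∸ R)) (λ t → + (m C (R + t)) *ℤ monoCoeff 0 t i j)
  coeff-by (suc m) R i j _ = trans (coeff-linExt (by (suc m) R) i j) (∑-map _ (upTo (suc (suc m) ∸ R)) _)

module Subsets where

  open import Defs using (allSubsets)
  open ListSums
  open Polynomials using (kron; kron-suc)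
  open import Data.Bool using (if_then_else_)
  import Data.Bool
  open import Data.Nat using (ℕ; zero; suc; _+_; _∸_; _<_; z≤n; s≤s)
  import Data.Nat.Properties as ℕₚ
  open import Data.Nat.Combinatorics using (_C_; nCk+nC[k+1]≡[n+1]C[k+1])
  open import Data.Integer using (ℤ; +_) renaming (_+_ to _+ℤ_; _*_ to _*ℤ_)
  import Data.Integer.Properties as ℤₚ
  open import Data.Fin using (Fin; zero; suc)
  open import Data.Fin.Subset using (Subset; inside; outside; _∈_; _∉_; _⊆_; _∪_; _∩_; _─_; _-_; ⁅_⁆; ∣_∣; ⊤; ⊥)
  open import Data.Fin.Subset.Properties
    using (_⊆?_; _∈?_; ⊆⊤; drop-∷-⊆; out⊆; s⊆s; ⊆-trans; ⊆-antisym; p⊆p∪q; q⊆p∪q; x∈p∪q⁻; x∈p∪q⁺; x∈p∩q⁺; x∈⁅x⁆; x∈⁅y⁆⇒x≡y;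
           p─q⊆p; x∈p∧x∉q⇒x∈p─q; x∈p∧x≢y⇒x∈p-y; p⊆q⇒∣p∣≤∣q∣; p─⊥≡p; x∈p⇒∣p-x∣<∣p∣)
  import Data.Fin.Properties as Finₚ
  open import Data.List using (List; []; _∷_; _++_; map)
  open import Data.List.Membership.Propositional using () renaming (_∈_ to _∈ₗ_)
  open import Data.List.Membership.Propositional.Properties using (∈-map⁺; ∈-map⁻; ∈-++⁺ˡ; ∈-++⁺ʳ; ∈-++⁻)
  open import Data.List.Relation.Unary.Any using (here)
  open import Data.List.Relation.Unary.Unique.Propositional using (Unique; []; _∷_)
  import Data.List.Relation.Unary.Unique.Propositional.Properties as Unique
  import Data.List.Relation.Unary.All as All
  open import Data.Product using (Σ; _×_; _,_)
  open import Data.Sum using (inj₁; inj₂)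
  open import Data.Vec using ([]; _∷_)
  open import Data.Vec.Base using (tabulate) renaming (here to hereᵥ; there to thereᵥ)
  import Data.Vec.Properties as Vecₚ
  open import Data.Empty using (⊥-elim)
  open import Relation.Unary using (Decidable)
  open import Induction.WellFounded using (WfRec)
  open import Data.Nat.Induction using (<-rec)
  open import Function using (_∘_)
  open import Relation.Binary.PropositionalEquality
  open import Relation.Nullary using (¬_; Dec; yes; no; does)
  open import Relation.Nullary.Decidable using (dec-true)

  private variable
    n : ℕ

  infix 4 _≟ₛ_
  _≟ₛ_ : (p q : Subset n) → Dec (p ≡ q)
  _≟ₛ_ = Vecₚ.≡-dec Data.Bool._≟_

  ∪-⊆ : {p q r : Subset n} → p ⊆ r → q ⊆ r → p ∪ q ⊆ r
  ∪-⊆ {p = p} {q} p⊆r q⊆r x∈ with x∈p∪q⁻ p q x∈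
  ... | inj₁ x∈p = p⊆r x∈p
  ... | inj₂ x∈q = q⊆r x∈q

  ⊆-∩ : {p q r : Subset n} → r ⊆ p → r ⊆ q → r ⊆ p ∩ q
  ⊆-∩ r⊆p r⊆q x∈ = x∈p∩q⁺ (r⊆p x∈ , r⊆q x∈)

  x∈p─q⇒x∉q : ∀ (p q : Subset n) {x} → x ∈ p ─ q → x ∉ q
  x∈p─q⇒x∉q (inside ∷ p) (outside ∷ q) hereᵥ ()
  x∈p─q⇒x∉q (_ ∷ p) (_ ∷ q) (thereᵥ x∈) (thereᵥ x∈q) = x∈p─q⇒x∉q p q x∈ x∈q

  ∪-mono : {p p′ q q′ : Subset n} → p ⊆ p′ → q ⊆ q′ → p ∪ q ⊆ p′ ∪ q′
  ∪-mono {p′ = p′} {q′ = q′} p⊆ q⊆ = ∪-⊆ (⊆-trans p⊆ (p⊆p∪q q′)) (⊆-trans q⊆ (q⊆p∪q p′ q′))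

  ⁅x⁆⊆ : {p : Subset n} {x : Fin n} → x ∈ p → ⁅ x ⁆ ⊆ p
  ⁅x⁆⊆ {x = x} x∈p y∈ = subst (_∈ _) (sym (x∈⁅y⁆⇒x≡y x y∈)) x∈p

  x∉p-x : (p : Subset n) {x : Fin n} → x ∉ p - x
  x∉p-x p {x} x∈ = x∈p─q⇒x∉q p ⁅ x ⁆ x∈ (x∈⁅x⁆ x)

  ⊆-∪-─ : (p q : Subset n) → p ⊆ q ∪ (p ─ q)
  ⊆-∪-─ p q {x} x∈p with x ∈? q
  ... | yes x∈q = x∈p∪q⁺ (inj₁ x∈q)
  ... | no x∉q = x∈p∪q⁺ (inj₂ (x∈p∧x∉q⇒x∈p─q x∈p x∉q))

  p─[p─q]≡q : {p q : Subset n} → q ⊆ p → p ─ (p ─ q) ≡ q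
  p─[p─q]≡q {p = p} {q} q⊆p = ⊆-antisym ⊆q (λ x∈q → x∈p∧x∉q⇒x∈p─q (q⊆p x∈q) (λ x∈ → x∈p─q⇒x∉q p q x∈ x∈q))
    where
    ⊆q : p ─ (p ─ q) ⊆ q
    ⊆q {x} x∈ with x ∈? q
    ... | yes x∈q = x∈q
    ... | no x∉q = ⊥-elim (x∈p─q⇒x∉q p (p ─ q) x∈ (x∈p∧x∉q⇒x∈p─q (p─q⊆p p (p ─ q) x∈) x∉q))

  [p-x]∪⁅x⁆≡p : {p : Subset n} {x : Fin n} → x ∈ p → (p - x) ∪ ⁅ x ⁆ ≡ p
  [p-x]∪⁅x⁆≡p {p = p} {x} x∈p = ⊆-antisym (∪-⊆ (p─q⊆p p ⁅ x ⁆) (⁅x⁆⊆ x∈p)) ⊇p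
    where
    ⊇p : p ⊆ (p - x) ∪ ⁅ x ⁆
    ⊇p {y} y∈p with y Finₚ.≟ x
    ... | yes refl = x∈p∪q⁺ (inj₂ (x∈⁅x⁆ x))
    ... | no y≢x = x∈p∪q⁺ (inj₁ (x∈p∧x≢y⇒x∈p-y y∈p y≢x))

  ∣p∪q∣≡∣p∣+∣q∣ : (p q : Subset n) → (∀ {x} → x ∈ p → x ∉ q) → ∣ p ∪ q ∣ ≡ ∣ p ∣ + ∣ q ∣
  ∣p∪q∣≡∣p∣+∣q∣ [] [] _ = refl
  ∣p∪q∣≡∣p∣+∣q∣ (inside ∷ p) (inside ∷ q) disj = ⊥-elim (disj hereᵥ hereᵥ)
  ∣p∪q∣≡∣p∣+∣q∣ (inside ∷ p) (outside ∷ q) disj =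
    cong suc (∣p∪q∣≡∣p∣+∣q∣ p q (λ x∈p x∈q → disj (thereᵥ x∈p) (thereᵥ x∈q)))
  ∣p∪q∣≡∣p∣+∣q∣ (outside ∷ p) (inside ∷ q) disj =
    trans (cong suc (∣p∪q∣≡∣p∣+∣q∣ p q (λ x∈p x∈q → disj (thereᵥ x∈p) (thereᵥ x∈q)))) (sym (ℕₚ.+-suc ∣ p ∣ ∣ q ∣))
  ∣p∪q∣≡∣p∣+∣q∣ (outside ∷ p) (outside ∷ q) disj = ∣p∪q∣≡∣p∣+∣q∣ p q (λ x∈p x∈q → disj (thereᵥ x∈p) (thereᵥ x∈q))

  ∣p-x∣+1≡∣p∣ : ∀ (p : Subset n) {x} → x ∈ p → suc ∣ p - x ∣ ≡ ∣ p ∣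
  ∣p-x∣+1≡∣p∣ (inside ∷ p) hereᵥ = cong (suc ∘ ∣_∣) (p─⊥≡p p)
  ∣p-x∣+1≡∣p∣ (inside ∷ p) (thereᵥ x∈) = cong suc (∣p-x∣+1≡∣p∣ p x∈)
  ∣p-x∣+1≡∣p∣ (outside ∷ p) (thereᵥ x∈) = ∣p-x∣+1≡∣p∣ p x∈

  ⊆∧∣∣≡⇒≡ : {p q : Subset n} → p ⊆ q → ∣ p ∣ ≡ ∣ q ∣ → p ≡ q
  ⊆∧∣∣≡⇒≡ {p = []} {[]} _ _ = refl
  ⊆∧∣∣≡⇒≡ {p = inside ∷ p} {inside ∷ q} p⊆q eq = cong (inside ∷_) (⊆∧∣∣≡⇒≡ (drop-∷-⊆ p⊆q) (ℕₚ.suc-injective eq))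
  ⊆∧∣∣≡⇒≡ {p = outside ∷ p} {outside ∷ q} p⊆q eq = cong (outside ∷_) (⊆∧∣∣≡⇒≡ (drop-∷-⊆ p⊆q) eq)
  ⊆∧∣∣≡⇒≡ {p = inside ∷ p} {outside ∷ q} p⊆q eq with p⊆q hereᵥ
  ... | ()
  ⊆∧∣∣≡⇒≡ {p = outside ∷ p} {inside ∷ q} p⊆q eq =
    ⊥-elim (ℕₚ.<-irrefl eq (s≤s (p⊆q⇒∣p∣≤∣q∣ (drop-∷-⊆ p⊆q))))

  ∣p∣≡0⇒p≡⊥ : (p : Subset n) → ∣ p ∣ ≡ 0 → p ≡ ⊥
  ∣p∣≡0⇒p≡⊥ [] _ = refl
  ∣p∣≡0⇒p≡⊥ (outside ∷ p) ∣p∣≡0 = cong (outside ∷_) (∣p∣≡0⇒p≡⊥ p ∣p∣≡0)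

  nonempty : (p : Subset n) → 0 < ∣ p ∣ → Σ (Fin n) (_∈ p)
  nonempty (inside ∷ p) _ = zero , hereᵥ
  nonempty (outside ∷ p) pos with nonempty p pos
  ... | x , x∈ = suc x , thereᵥ x∈

  removal-induction : (P : Subset n → Set) → P ⊥ → (∀ K {x} → x ∈ K → P (K - x) → P K) → ∀ K → P K
  removal-induction P base step = go
    where
    go : ∀ K → P K
    go K = <-rec (λ m → ∀ K → ∣ K ∣ ≡ m → P K) rec ∣ K ∣ K refl
      where
      rec : ∀ m → WfRec _<_ (λ m → ∀ K → ∣ K ∣ ≡ m → P K) m → ∀ K → ∣ K ∣ ≡ m → P K
      rec zero _ K ∣K∣≡0 = subst P (sym (∣p∣≡0⇒p≡⊥ K ∣K∣≡0)) base
      rec (suc m) ih K ∣K∣≡1+m with nonempty K (subst (0 <_) (sym ∣K∣≡1+m) (s≤s z≤n))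
      ... | x , x∈K = step K x∈K (ih (subst (∣ K - x ∣ <_) ∣K∣≡1+m (x∈p⇒∣p-x∣<∣p∣ x∈K)) (K - x) refl)

  select : {P : Fin n → Set} → Decidable P → Subset n
  select P? = tabulate (λ x → does (P? x))

  module _ {P : Fin n → Set} (P? : Decidable P) {x : Fin n} where

    ∈-select⁺ : P x → x ∈ select P?
    ∈-select⁺ px = Vecₚ.lookup⇒[]= x _ (trans (Vecₚ.lookup∘tabulate _ x) (dec-true (P? x) px))

    ∈-select⁻ : x ∈ select P? → P x
    ∈-select⁻ x∈ = does⇒ (P? x) (trans (sym (Vecₚ.lookup∘tabulate _ x)) (Vecₚ.[]=⇒lookup x∈))

  subsetsOf : Subset n → List (Subset n)
  subsetsOf [] = [] ∷ []
  subsetsOf (outside ∷ Y) = map (outside ∷_) (subsetsOf Y)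
  subsetsOf (inside ∷ Y) = map (outside ∷_) (subsetsOf Y) ++ map (inside ∷_) (subsetsOf Y)

  subsetsOf-⊤ : ∀ n → subsetsOf (⊤ {n}) ≡ allSubsets n
  subsetsOf-⊤ zero = refl
  subsetsOf-⊤ (suc n) = cong (λ Ss → map (outside ∷_) Ss ++ map (inside ∷_) Ss) (subsetsOf-⊤ n)

  ∈-subsetsOf⁺ : {S Y : Subset n} → S ⊆ Y → S ∈ₗ subsetsOf Y
  ∈-subsetsOf⁺ {S = []} {[]} _ = here refl
  ∈-subsetsOf⁺ {S = outside ∷ S} {outside ∷ Y} S⊆Y = ∈-map⁺ (_ ∷_) (∈-subsetsOf⁺ (drop-∷-⊆ S⊆Y))
  ∈-subsetsOf⁺ {S = outside ∷ S} {inside ∷ Y} S⊆Y = ∈-++⁺ˡ (∈-map⁺ (_ ∷_) (∈-subsetsOf⁺ (drop-∷-⊆ S⊆Y)))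
  ∈-subsetsOf⁺ {S = inside ∷ S} {inside ∷ Y} S⊆Y = ∈-++⁺ʳ _ (∈-map⁺ (_ ∷_) (∈-subsetsOf⁺ (drop-∷-⊆ S⊆Y)))
  ∈-subsetsOf⁺ {S = inside ∷ S} {outside ∷ Y} S⊆Y with S⊆Y hereᵥ
  ... | ()

  ∈-subsetsOf⁻ : {S Y : Subset n} → S ∈ₗ subsetsOf Y → S ⊆ Y
  ∈-subsetsOf⁻ {Y = []} (here refl) = λ ()
  ∈-subsetsOf⁻ {Y = outside ∷ Y} S∈ with ∈-map⁻ (_ ∷_) S∈
  ... | S , S∈' , refl = out⊆ (∈-subsetsOf⁻ S∈')
  ∈-subsetsOf⁻ {Y = inside ∷ Y} S∈ with ∈-++⁻ (map (outside ∷_) (subsetsOf Y)) S∈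
  ... | inj₁ S∈ˡ with ∈-map⁻ (_ ∷_) S∈ˡ
  ...   | S , S∈' , refl = out⊆ (∈-subsetsOf⁻ S∈')
  ∈-subsetsOf⁻ {Y = inside ∷ Y} S∈ | inj₂ S∈ʳ with ∈-map⁻ (_ ∷_) S∈ʳ
  ...   | S , S∈' , refl = s⊆s (∈-subsetsOf⁻ S∈')

  subsetsOf-unique : (Y : Subset n) → Unique (subsetsOf Y)
  subsetsOf-unique [] = All.[] ∷ []
  subsetsOf-unique (outside ∷ Y) = Unique.map⁺ Vecₚ.∷-injectiveʳ (subsetsOf-unique Y)
  subsetsOf-unique (inside ∷ Y) =
    Unique.++⁺ (Unique.map⁺ Vecₚ.∷-injectiveʳ (subsetsOf-unique Y)) (Unique.map⁺ Vecₚ.∷-injectiveʳ (subsetsOf-unique Y))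
               heads-differ
    where
    heads-differ : ∀ {V} → ¬ (V ∈ₗ map (outside ∷_) (subsetsOf Y) × V ∈ₗ map (inside ∷_) (subsetsOf Y))
    heads-differ (V∈ˡ , V∈ʳ) with ∈-map⁻ (_ ∷_) V∈ˡ | ∈-map⁻ (_ ∷_) V∈ʳ
    ... | _ , _ , refl | _ , _ , ()

  module _ (Y : Subset n) where

    ∑-subsetsOf-cong : {f g : Subset n → ℤ} → (∀ S → S ⊆ Y → f S ≡ g S) →
                       ∑ (subsetsOf Y) f ≡ ∑ (subsetsOf Y) g
    ∑-subsetsOf-cong f≗g = ∑-cong-∈ (subsetsOf Y) (λ S S∈ → f≗g S (∈-subsetsOf⁻ S∈))

    ∑-subsetsOf-zero : {f : Subset n → ℤ} → (∀ S → S ⊆ Y → f S ≡ + 0) → ∑ (subsetsOf Y) f ≡ + 0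
    ∑-subsetsOf-zero f≗0 = ∑-zero-∈ (subsetsOf Y) (λ S S∈ → f≗0 S (∈-subsetsOf⁻ S∈))

    ∑-subsetsOf-single : (f : Subset n → ℤ) {V : Subset n} → V ⊆ Y →
                         (∀ S → S ⊆ Y → S ≢ V → f S ≡ + 0) → ∑ (subsetsOf Y) f ≡ f V
    ∑-subsetsOf-single f V⊆Y others =
      ∑-unique f (subsetsOf-unique Y) (∈-subsetsOf⁺ V⊆Y) (λ S S∈ → others S (∈-subsetsOf⁻ S∈))

  ∑-allSubsets-≟ₛ : ∀ {n} (V : Subset n) (f : Subset n → ℤ) →
                    ∑ (allSubsets n) (λ W → if does (W ≟ₛ V) then f W else + 0) ≡ f V
  ∑-allSubsets-≟ₛ {n} V f = begin
    ∑ (allSubsets n) (λ W → if does (W ≟ₛ V) then f W else + 0)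
      ≡⟨ cong (λ Ss → ∑ Ss (λ W → if does (W ≟ₛ V) then f W else + 0)) (sym (subsetsOf-⊤ n)) ⟩
    ∑ (subsetsOf ⊤) (λ W → if does (W ≟ₛ V) then f W else + 0)
      ≡⟨ ∑-subsetsOf-single ⊤ _ ⊆⊤ (λ W _ W≢V → if-no (W ≟ₛ V) W≢V) ⟩
    (if does (V ≟ₛ V) then f V else + 0)
      ≡⟨ if-yes (V ≟ₛ V) refl ⟩
    f V ∎
    where open ≡-Reasoning

  ∑-subsetsOf-outside : (Y : Subset n) (f : Subset (suc n) → ℤ) →
                        ∑ (subsetsOf (outside ∷ Y)) f ≡ ∑ (subsetsOf Y) (λ S → f (outside ∷ S))
  ∑-subsetsOf-outside Y f = ∑-map (outside ∷_) (subsetsOf Y) f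

  ∑-subsetsOf-inside : (Y : Subset n) (f : Subset (suc n) → ℤ) →
                       ∑ (subsetsOf (inside ∷ Y)) f
                       ≡ ∑ (subsetsOf Y) (λ S → f (outside ∷ S)) +ℤ ∑ (subsetsOf Y) (λ S → f (inside ∷ S))
  ∑-subsetsOf-inside Y f = trans (∑-++ (map (outside ∷_) (subsetsOf Y)) _ f)
    (cong₂ _+ℤ_ (∑-map (outside ∷_) (subsetsOf Y) f) (∑-map (inside ∷_) (subsetsOf Y) f))

  -- every S ⊆ Y is uniquely T ∪ J with T ⊆ Y ∩ W and J ⊆ Y ─ W
  ∑-subsetsOf-split : (Y W : Subset n) (g : Subset n → ℤ) →
    ∑ (subsetsOf Y) g ≡ ∑ (subsetsOf (Y ∩ W)) (λ T → ∑ (subsetsOf (Y ─ W)) (λ J → g (T ∪ J)))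
  ∑-subsetsOf-split-outside : (Y W : Subset n) (g : Subset (suc n) → ℤ) →
    ∑ (subsetsOf (outside ∷ Y)) g
    ≡ ∑ (subsetsOf (outside ∷ (Y ∩ W))) (λ T → ∑ (subsetsOf (outside ∷ (Y ─ W))) (λ J → g (T ∪ J)))

  ∑-subsetsOf-split [] [] g = sym (ℤₚ.+-identityʳ (g [] +ℤ + 0))
  ∑-subsetsOf-split (outside ∷ Y) (inside ∷ W) g = ∑-subsetsOf-split-outside Y W g
  ∑-subsetsOf-split (outside ∷ Y) (outside ∷ W) g = ∑-subsetsOf-split-outside Y W g
  ∑-subsetsOf-split (inside ∷ Y) (inside ∷ W) g = begin
    ∑ (subsetsOf (inside ∷ Y)) g
      ≡⟨ ∑-subsetsOf-inside Y g ⟩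
    ∑ (subsetsOf Y) (λ S → g (outside ∷ S)) +ℤ ∑ (subsetsOf Y) (λ S → g (inside ∷ S))
      ≡⟨ cong₂ _+ℤ_ (split-with outside) (split-with inside) ⟩
    ∑ (subsetsOf (Y ∩ W)) (λ T → ∑ (subsetsOf (outside ∷ (Y ─ W))) (λ J → g ((outside ∷ T) ∪ J)))
      +ℤ ∑ (subsetsOf (Y ∩ W)) (λ T → ∑ (subsetsOf (outside ∷ (Y ─ W))) (λ J → g ((inside ∷ T) ∪ J)))
      ≡⟨ sym (∑-subsetsOf-inside (Y ∩ W) (λ T → ∑ (subsetsOf (outside ∷ (Y ─ W))) (λ J → g (T ∪ J)))) ⟩
    ∑ (subsetsOf (inside ∷ (Y ∩ W))) (λ T → ∑ (subsetsOf (outside ∷ (Y ─ W))) (λ J → g (T ∪ J)))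
      ∎
    where
    open ≡-Reasoning
    split-with : ∀ b → ∑ (subsetsOf Y) (λ S → g (b ∷ S))
                       ≡ ∑ (subsetsOf (Y ∩ W)) (λ T → ∑ (subsetsOf (outside ∷ (Y ─ W))) (λ J → g ((b ∷ T) ∪ J)))
    split-with outside = trans (∑-subsetsOf-split Y W (λ S → g (outside ∷ S)))
      (∑-cong (subsetsOf (Y ∩ W)) (λ T → sym (∑-subsetsOf-outside (Y ─ W) (λ J → g ((outside ∷ T) ∪ J)))))
    split-with inside = trans (∑-subsetsOf-split Y W (λ S → g (inside ∷ S)))
      (∑-cong (subsetsOf (Y ∩ W)) (λ T → sym (∑-subsetsOf-outside (Y ─ W) (λ J → g ((inside ∷ T) ∪ J)))))
  ∑-subsetsOf-split (inside ∷ Y) (outside ∷ W) g = begin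
    ∑ (subsetsOf (inside ∷ Y)) g
      ≡⟨ ∑-subsetsOf-inside Y g ⟩
    ∑ (subsetsOf Y) (λ S → g (outside ∷ S)) +ℤ ∑ (subsetsOf Y) (λ S → g (inside ∷ S))
      ≡⟨ cong₂ _+ℤ_ (∑-subsetsOf-split Y W _) (∑-subsetsOf-split Y W _) ⟩
    ∑ (subsetsOf (Y ∩ W)) (λ T → ∑ (subsetsOf (Y ─ W)) (λ J → g (outside ∷ (T ∪ J))))
      +ℤ ∑ (subsetsOf (Y ∩ W)) (λ T → ∑ (subsetsOf (Y ─ W)) (λ J → g (inside ∷ (T ∪ J))))
      ≡⟨ sym (∑-+ (subsetsOf (Y ∩ W)) _ _) ⟩
    ∑ (subsetsOf (Y ∩ W)) (λ T → ∑ (subsetsOf (Y ─ W)) (λ J → g (outside ∷ (T ∪ J)))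
                                +ℤ ∑ (subsetsOf (Y ─ W)) (λ J → g (inside ∷ (T ∪ J))))
      ≡⟨ ∑-cong (subsetsOf (Y ∩ W)) (λ T → sym (∑-subsetsOf-inside (Y ─ W) (λ J → g ((outside ∷ T) ∪ J)))) ⟩
    ∑ (subsetsOf (Y ∩ W)) (λ T → ∑ (subsetsOf (inside ∷ (Y ─ W))) (λ J → g ((outside ∷ T) ∪ J)))
      ≡⟨ sym (∑-subsetsOf-outside (Y ∩ W) _) ⟩
    ∑ (subsetsOf (outside ∷ (Y ∩ W))) (λ T → ∑ (subsetsOf (inside ∷ (Y ─ W))) (λ J → g (T ∪ J)))
      ∎
    where open ≡-Reasoning

  ∑-subsetsOf-split-outside Y W g = begin
    ∑ (subsetsOf (outside ∷ Y)) g
      ≡⟨ ∑-subsetsOf-outside Y g ⟩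
    ∑ (subsetsOf Y) (λ S → g (outside ∷ S))
      ≡⟨ ∑-subsetsOf-split Y W _ ⟩
    ∑ (subsetsOf (Y ∩ W)) (λ T → ∑ (subsetsOf (Y ─ W)) (λ J → g (outside ∷ (T ∪ J))))
      ≡⟨ ∑-cong (subsetsOf (Y ∩ W)) (λ T → sym (∑-subsetsOf-outside (Y ─ W) (λ J → g ((outside ∷ T) ∪ J)))) ⟩
    ∑ (subsetsOf (Y ∩ W)) (λ T → ∑ (subsetsOf (outside ∷ (Y ─ W))) (λ J → g ((outside ∷ T) ∪ J)))
      ≡⟨ sym (∑-subsetsOf-outside (Y ∩ W) _) ⟩
    ∑ (subsetsOf (outside ∷ (Y ∩ W))) (λ T → ∑ (subsetsOf (outside ∷ (Y ─ W))) (λ J → g (T ∪ J)))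
      ∎
    where open ≡-Reasoning

  extendsBy : Subset n → ℕ → Subset n → ℤ
  extendsBy X t S = if does (X ⊆? S) then kron t (∣ S ∣ ∸ ∣ X ∣) else + 0

  extendsBy-inside : ∀ (X S : Subset n) t → extendsBy (outside ∷ X) (suc t) (inside ∷ S) ≡ extendsBy X t S
  extendsBy-inside X S t with X ⊆? S
  ... | yes X⊆S = trans (cong (kron (suc t)) (ℕₚ.+-∸-assoc 1 (p⊆q⇒∣p∣≤∣q∣ X⊆S))) (kron-suc t _)
  ... | no _ = refl

  extendsBy-inside-0 : ∀ (X S : Subset n) → extendsBy (outside ∷ X) 0 (inside ∷ S) ≡ + 0
  extendsBy-inside-0 X S with X ⊆? S
  ... | yes X⊆S = cong (kron 0) (ℕₚ.+-∸-assoc 1 (p⊆q⇒∣p∣≤∣q∣ X⊆S))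
  ... | no _ = refl

  ∑-subsetsOf-extendsBy : (X Y : Subset n) (t : ℕ) → X ⊆ Y →
                          ∑ (subsetsOf Y) (extendsBy X t) ≡ + ((∣ Y ∣ ∸ ∣ X ∣) C t)
  ∑-subsetsOf-extendsBy [] [] zero _ = refl
  ∑-subsetsOf-extendsBy [] [] (suc t) _ = refl
  ∑-subsetsOf-extendsBy (outside ∷ X) (outside ∷ Y) t X⊆Y =
    trans (∑-subsetsOf-outside Y (extendsBy (outside ∷ X) t)) (∑-subsetsOf-extendsBy X Y t (drop-∷-⊆ X⊆Y))
  ∑-subsetsOf-extendsBy (inside ∷ X) (outside ∷ Y) t X⊆Y with X⊆Y hereᵥ
  ... | ()
  ∑-subsetsOf-extendsBy (inside ∷ X) (inside ∷ Y) t X⊆Y =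
    trans (∑-subsetsOf-inside Y (extendsBy (inside ∷ X) t))
          (trans (cong₂ _+ℤ_ (∑-zero (subsetsOf Y)) (∑-subsetsOf-extendsBy X Y t (drop-∷-⊆ X⊆Y)))
                 (ℤₚ.+-identityˡ _))
  ∑-subsetsOf-extendsBy (outside ∷ X) (inside ∷ Y) zero X⊆Y =
    trans (∑-subsetsOf-inside Y (extendsBy (outside ∷ X) 0))
          (cong₂ _+ℤ_ (∑-subsetsOf-extendsBy X Y 0 (drop-∷-⊆ X⊆Y)) (∑-subsetsOf-zero Y (λ S _ → extendsBy-inside-0 X S)))
  ∑-subsetsOf-extendsBy (outside ∷ X) (inside ∷ Y) (suc t) X⊆Y = begin
    ∑ (subsetsOf (inside ∷ Y)) (extendsBy (outside ∷ X) (suc t))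
      ≡⟨ ∑-subsetsOf-inside Y (extendsBy (outside ∷ X) (suc t)) ⟩
    ∑ (subsetsOf Y) (extendsBy X (suc t)) +ℤ ∑ (subsetsOf Y) (λ S → extendsBy (outside ∷ X) (suc t) (inside ∷ S))
      ≡⟨ cong₂ _+ℤ_ (∑-subsetsOf-extendsBy X Y (suc t) X'⊆Y')
                    (trans (∑-cong (subsetsOf Y) (λ S → extendsBy-inside X S t)) (∑-subsetsOf-extendsBy X Y t X'⊆Y')) ⟩
    + (m C suc t) +ℤ + (m C t)
      ≡⟨ cong +_ (trans (ℕₚ.+-comm (m C suc t) (m C t)) (nCk+nC[k+1]≡[n+1]C[k+1] m t)) ⟩
    + (suc m C suc t)
      ≡⟨ cong (λ k → + (k C suc t)) (sym (ℕₚ.+-∸-assoc 1 (p⊆q⇒∣p∣≤∣q∣ X'⊆Y'))) ⟩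
    + ((suc ∣ Y ∣ ∸ ∣ X ∣) C suc t)
      ∎
    where
    open ≡-Reasoning
    m = ∣ Y ∣ ∸ ∣ X ∣
    X'⊆Y' = drop-∷-⊆ X⊆Y

  ∑-subsetsOf-sizes : {A : Set} (X Y : Subset n) → X ⊆ Y → (ts : List A) (e : A → ℕ) (g : A → ℤ) →
    ∑ (subsetsOf Y) (λ S → if does (X ⊆? S) then ∑ ts (λ t → kron (e t) (∣ S ∣ ∸ ∣ X ∣) *ℤ g t) else + 0)
    ≡ ∑ ts (λ t → + ((∣ Y ∣ ∸ ∣ X ∣) C e t) *ℤ g t)
  ∑-subsetsOf-sizes X Y X⊆Y ts e g = begin
    ∑ (subsetsOf Y) (λ S → if does (X ⊆? S) then ∑ ts (λ t → kron (e t) (∣ S ∣ ∸ ∣ X ∣) *ℤ g t) else + 0)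
      ≡⟨ ∑-cong (subsetsOf Y) (λ S → weigh S (X ⊆? S)) ⟩
    ∑ (subsetsOf Y) (λ S → ∑ ts (λ t → extendsBy X (e t) S *ℤ g t))
      ≡⟨ ∑-comm (subsetsOf Y) ts _ ⟩
    ∑ ts (λ t → ∑ (subsetsOf Y) (λ S → extendsBy X (e t) S *ℤ g t))
      ≡⟨ ∑-cong ts (λ t → trans (∑-*ʳ (subsetsOf Y) (extendsBy X (e t)) (g t))
                                 (cong (_*ℤ g t) (∑-subsetsOf-extendsBy X Y (e t) X⊆Y))) ⟩
    ∑ ts (λ t → + ((∣ Y ∣ ∸ ∣ X ∣) C e t) *ℤ g t)
      ∎
    where
    open ≡-Reasoning
    weigh : ∀ S → Dec (X ⊆ S) →
            (if does (X ⊆? S) then ∑ ts (λ t → kron (e t) (∣ S ∣ ∸ ∣ X ∣) *ℤ g t) else + 0)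
            ≡ ∑ ts (λ t → extendsBy X (e t) S *ℤ g t)
    weigh S (yes X⊆S) = trans (if-yes (X ⊆? S) X⊆S)
      (∑-cong ts (λ t → cong (_*ℤ g t) (sym (if-yes (X ⊆? S) X⊆S))))
    weigh S (no X⊈S) = trans (if-no (X ⊆? S) X⊈S)
      (sym (∑-zero-∈ ts (λ t _ → cong (_*ℤ g t) (if-no (X ⊆? S) X⊈S))))

module MatroidClosure {n : ℕ} (M : Matroid n) where
  open Subsets
  open import Data.Nat using (suc; _+_; _∸_; _≤_; _<_; _≟_)
  import Data.Nat.Properties as ℕₚ
  import Data.Fin.Properties as Finₚ
  open import Data.Fin.Subset using (Subset; _∈_; _∉_; _⊆_; _∪_; _∩_; _─_; _-_; ⁅_⁆; ∣_∣; ⊥)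
  open import Data.Fin.Subset.Properties
    using (_∈?_; ⊆-refl; ⊆-trans; ⊆-antisym; p⊆p∪q; q⊆p∪q; x∈p∪q⁻; x∈p∪q⁺; x∈⁅x⁆;
           p─q⊆p; x∈p∧x∉q⇒x∈p─q; x∈p∧x≢y⇒x∈p-y; p─q─r≡p─q∪r; p─⊥≡p; ∣⊥∣≡0; ∪-identityʳ; ∪-assoc; p⊆q⇒∣p∣≤∣q∣)
  open import Data.Product using (_×_; _,_; proj₁; proj₂)
  open import Data.Sum using (inj₁; inj₂)
  open import Data.Empty using (⊥-elim)
  open import Relation.Binary.PropositionalEquality
  open import Function using (_∘_)
  open import Relation.Nullary using (yes; no)
  open import Relation.Nullary.Decidable using (_×-dec_)

  open Matroid M renaming (rank to r)

  rank-⊥ : r ⊥ ≡ 0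
  rank-⊥ = ℕₚ.n≤0⇒n≡0 (ℕₚ.≤-trans (r-card ⊥) (ℕₚ.≤-reflexive (∣⊥∣≡0 n)))

  submodular : ∀ {A B C} → C ⊆ A ∩ B → r (A ∪ B) + r C ≤ r A + r B
  submodular {A} {B} C⊆ = ℕₚ.≤-trans (ℕₚ.+-monoʳ-≤ (r (A ∪ B)) (r-mono C⊆)) (r-submod A B)

  rank-∪-≤ : ∀ A B → r (A ∪ B) ≤ r A + ∣ B ∣
  rank-∪-≤ A B = begin
    r (A ∪ B)               ≤⟨ ℕₚ.m≤m+n _ _ ⟩
    r (A ∪ B) + r (A ∩ B)   ≤⟨ r-submod A B ⟩
    r A + r B               ≤⟨ ℕₚ.+-monoʳ-≤ (r A) (r-card B) ⟩
    r A + ∣ B ∣             ∎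
    where open ℕₚ.≤-Reasoning

  rank-∸-≤-card-∸ : ∀ {X S} → X ⊆ S → r S ∸ r X ≤ ∣ S ∣ ∸ ∣ X ∣
  rank-∸-≤-card-∸ {X} {S} X⊆S = begin
    r S ∸ r X                     ≤⟨ ℕₚ.∸-monoˡ-≤ (r X) (ℕₚ.≤-trans (r-mono (⊆-∪-─ S X)) (rank-∪-≤ X (S ─ X))) ⟩
    (r X + ∣ S ─ X ∣) ∸ r X        ≡⟨ ℕₚ.m+n∸m≡n (r X) _ ⟩
    ∣ S ─ X ∣                     ≡⟨ sym (ℕₚ.m+n∸m≡n ∣ X ∣ _) ⟩
    (∣ X ∣ + ∣ S ─ X ∣) ∸ ∣ X ∣    ≡⟨ cong (_∸ ∣ X ∣) (sym ∣S∣) ⟩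
    ∣ S ∣ ∸ ∣ X ∣                 ∎
    where
    open ℕₚ.≤-Reasoning
    ∣S∣ : ∣ S ∣ ≡ ∣ X ∣ + ∣ S ─ X ∣
    ∣S∣ = trans (cong ∣_∣ (sym (⊆-antisym (∪-⊆ X⊆S (p─q⊆p S X)) (⊆-∪-─ S X))))
                (∣p∪q∣≡∣p∣+∣q∣ X (S ─ X) (λ x∈X x∈S─X → x∈p─q⇒x∉q S X x∈S─X x∈X))

  rank-∪-stable : ∀ {S F Z} → S ⊆ F → r (S ∪ Z) ≡ r S → r (F ∪ Z) ≡ r F
  rank-∪-stable {S} {F} {Z} S⊆F rS = ℕₚ.≤-antisym (ℕₚ.+-cancelʳ-≤ (r S) _ _ (begin
    r (F ∪ Z) + r S           ≤⟨ ℕₚ.+-monoˡ-≤ (r S) (r-mono (∪-mono ⊆-refl (q⊆p∪q S Z))) ⟩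
    r (F ∪ (S ∪ Z)) + r S     ≤⟨ submodular (⊆-∩ S⊆F (p⊆p∪q Z)) ⟩
    r F + r (S ∪ Z)           ≡⟨ cong (r F +_) rS ⟩
    r F + r S                 ∎)) (r-mono (p⊆p∪q Z))
    where open ℕₚ.≤-Reasoning

  rank-∪-neutral : ∀ S K → (∀ {x} → x ∈ K → r (S ∪ ⁅ x ⁆) ≡ r S) → r (S ∪ K) ≡ r S
  rank-∪-neutral S = removal-induction (λ K → (∀ {x} → x ∈ K → r (S ∪ ⁅ x ⁆) ≡ r S) → r (S ∪ K) ≡ r S)
    (λ _ → cong r (∪-identityʳ S)) step
    where
    step : ∀ K {x} → x ∈ K → ((∀ {y} → y ∈ K - x → r (S ∪ ⁅ y ⁆) ≡ r S) → r (S ∪ (K - x)) ≡ r S) →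
           (∀ {y} → y ∈ K → r (S ∪ ⁅ y ⁆) ≡ r S) → r (S ∪ K) ≡ r S
    step K {x} x∈K ih neutral = begin
      r (S ∪ K)                     ≡⟨ cong (λ Z → r (S ∪ Z)) (sym ([p-x]∪⁅x⁆≡p x∈K)) ⟩
      r (S ∪ ((K - x) ∪ ⁅ x ⁆))     ≡⟨ cong r (sym (∪-assoc S (K - x) ⁅ x ⁆)) ⟩
      r ((S ∪ (K - x)) ∪ ⁅ x ⁆)     ≡⟨ rank-∪-stable (p⊆p∪q (K - x)) (neutral x∈K) ⟩
      r (S ∪ (K - x))               ≡⟨ ih (λ y∈ → neutral (p─q⊆p K ⁅ x ⁆ y∈)) ⟩
      r S                           ∎
      where open ≡-Reasoning

  cl : Subset n → Subset n
  cl S = select (λ e → r (S ∪ ⁅ e ⁆) ≟ r S)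

  ∈-cl⁺ : ∀ {S e} → r (S ∪ ⁅ e ⁆) ≡ r S → e ∈ cl S
  ∈-cl⁺ {S} = ∈-select⁺ (λ e → r (S ∪ ⁅ e ⁆) ≟ r S)

  ∈-cl⁻ : ∀ {S e} → e ∈ cl S → r (S ∪ ⁅ e ⁆) ≡ r S
  ∈-cl⁻ {S} = ∈-select⁻ (λ e → r (S ∪ ⁅ e ⁆) ≟ r S)

  ⊆-cl : ∀ {S} → S ⊆ cl S
  ⊆-cl {S} e∈S = ∈-cl⁺ (cong r (⊆-antisym (∪-⊆ ⊆-refl (⁅x⁆⊆ e∈S)) (p⊆p∪q _)))

  rank-cl : ∀ S → r (cl S) ≡ r S
  rank-cl S = trans (cong r (sym S∪clS≡clS)) (rank-∪-neutral S (cl S) ∈-cl⁻)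
    where
    S∪clS≡clS : S ∪ cl S ≡ cl S
    S∪clS≡clS = ⊆-antisym (∪-⊆ ⊆-cl ⊆-refl) (q⊆p∪q S (cl S))

  cl-flat : ∀ S → Flat M (cl S)
  cl-flat S e rank≡ = ∈-cl⁺ (ℕₚ.≤-antisym (begin
    r (S ∪ ⁅ e ⁆)        ≤⟨ r-mono (∪-mono ⊆-cl ⊆-refl) ⟩
    r (cl S ∪ ⁅ e ⁆)     ≡⟨ rank≡ ⟩
    r (cl S)             ≡⟨ rank-cl S ⟩
    r S                  ∎) (r-mono (p⊆p∪q _)))
    where open ℕₚ.≤-Reasoning

  cl-least : ∀ {S F} → Flat M F → S ⊆ F → cl S ⊆ F
  cl-least F-flat S⊆F {e} e∈ = F-flat e (rank-∪-stable S⊆F (∈-cl⁻ e∈))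

  cl-of-flat : ∀ {F} → Flat M F → cl F ≡ F
  cl-of-flat F-flat = ⊆-antisym (cl-least F-flat ⊆-refl) ⊆-cl

  cl-cong : ∀ {S S′} → S ⊆ S′ → r S ≡ r S′ → cl S ≡ cl S′
  cl-cong {S} {S′} S⊆S′ rank≡ =
    ⊆-antisym (cl-least (cl-flat S′) (⊆-trans S⊆S′ ⊆-cl)) (cl-least (cl-flat S) S′⊆clS)
    where
    S′⊆clS : S′ ⊆ cl S
    S′⊆clS x∈ = ∈-cl⁺ (ℕₚ.≤-antisym (ℕₚ.≤-trans (r-mono (∪-⊆ S⊆S′ (⁅x⁆⊆ x∈))) (ℕₚ.≤-reflexive (sym rank≡)))
                                     (r-mono (p⊆p∪q _)))

  cyc : Subset n → Subset n
  cyc S = select (λ e → (e ∈? S) ×-dec (r (S - e) ≟ r S))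

  ∈-cyc⁺ : ∀ {S e} → e ∈ S → r (S - e) ≡ r S → e ∈ cyc S
  ∈-cyc⁺ {S} e∈S rank≡ = ∈-select⁺ (λ e → (e ∈? S) ×-dec (r (S - e) ≟ r S)) (e∈S , rank≡)

  ∈-cyc⁻ : ∀ {S e} → e ∈ cyc S → e ∈ S × r (S - e) ≡ r S
  ∈-cyc⁻ {S} = ∈-select⁻ (λ e → (e ∈? S) ×-dec (r (S - e) ≟ r S))

  cyc-⊆ : ∀ {S} → cyc S ⊆ S
  cyc-⊆ e∈ = proj₁ (∈-cyc⁻ e∈)

  coloop-rank : ∀ {S e} → e ∈ S → e ∉ cyc S → r (S - e) < r S
  coloop-rank {S} {e} e∈S e∉ = ℕₚ.≤∧≢⇒< (r-mono (p─q⊆p S ⁅ e ⁆)) (λ rank≡ → e∉ (∈-cyc⁺ e∈S rank≡))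

  exchange : ∀ {B F e} → e ∈ B → B ⊆ F → r F + r (B - e) ≤ r (F - e) + r B
  exchange {B} {F} {e} e∈B B⊆F = begin
    r F + r (B - e)                ≤⟨ ℕₚ.+-monoˡ-≤ (r (B - e)) (r-mono F⊆) ⟩
    r ((F - e) ∪ B) + r (B - e)    ≤⟨ submodular (⊆-∩ B-e⊆F-e (p─q⊆p B ⁅ e ⁆)) ⟩
    r (F - e) + r B                ∎
    where
    open ℕₚ.≤-Reasoning
    B-e⊆F-e : B - e ⊆ F - e
    B-e⊆F-e x∈ = x∈p∧x∉q⇒x∈p─q (B⊆F (p─q⊆p B ⁅ e ⁆ x∈)) (x∈p─q⇒x∉q B ⁅ e ⁆ x∈)
    F⊆ : F ⊆ (F - e) ∪ B
    F⊆ = subst (λ Z → Z ⊆ (F - e) ∪ B) ([p-x]∪⁅x⁆≡p {p = F} (B⊆F e∈B)) (∪-mono ⊆-refl (⁅x⁆⊆ e∈B))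

  coloop-restrict : ∀ {B F e} → e ∈ B → B ⊆ F → r (F - e) < r F → r (B - e) < r B
  coloop-restrict {B} {F} {e} e∈B B⊆F coloop = ℕₚ.+-cancelˡ-≤ (r (F - e)) (suc (r (B - e))) (r B) (begin
    r (F - e) + suc (r (B - e))    ≡⟨ ℕₚ.+-suc (r (F - e)) _ ⟩
    suc (r (F - e)) + r (B - e)    ≤⟨ ℕₚ.+-monoˡ-≤ (r (B - e)) coloop ⟩
    r F + r (B - e)                ≤⟨ exchange e∈B B⊆F ⟩
    r (F - e) + r B                ∎)
    where open ℕₚ.≤-Reasoning

  rank-─-coloops : ∀ F K → K ⊆ F → (∀ {e} → e ∈ K → r (F - e) < r F) → r (F ─ K) + ∣ K ∣ ≤ r F
  rank-─-coloops F = removal-induction (λ K → K ⊆ F → (∀ {e} → e ∈ K → r (F - e) < r F) → r (F ─ K) + ∣ K ∣ ≤ r F)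
    (λ _ _ → ℕₚ.≤-reflexive (trans (cong₂ _+_ (cong r (p─⊥≡p F)) (∣⊥∣≡0 n)) (ℕₚ.+-identityʳ (r F))))
    step
    where
    step : ∀ K {x} → x ∈ K →
           (K - x ⊆ F → (∀ {e} → e ∈ K - x → r (F - e) < r F) → r (F ─ (K - x)) + ∣ K - x ∣ ≤ r F) →
           K ⊆ F → (∀ {e} → e ∈ K → r (F - e) < r F) → r (F ─ K) + ∣ K ∣ ≤ r F
    step K {x} x∈K ih K⊆F coloops = begin
      r (F ─ K) + ∣ K ∣                 ≡⟨ cong (r (F ─ K) +_) (sym (∣p-x∣+1≡∣p∣ K x∈K)) ⟩
      r (F ─ K) + suc ∣ K - x ∣         ≡⟨ ℕₚ.+-suc (r (F ─ K)) _ ⟩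
      suc (r (F ─ K)) + ∣ K - x ∣       ≤⟨ ℕₚ.+-monoˡ-≤ ∣ K - x ∣ (subst (λ Z → r Z < r B) B-x≡F─K lt) ⟩
      r B + ∣ K - x ∣                   ≤⟨ ih (⊆-trans (p─q⊆p K ⁅ x ⁆) K⊆F) (λ e∈ → coloops (p─q⊆p K ⁅ x ⁆ e∈)) ⟩
      r F                               ∎
      where
      open ℕₚ.≤-Reasoning
      B = F ─ (K - x)
      lt : r (B - x) < r B
      lt = coloop-restrict (x∈p∧x∉q⇒x∈p─q (K⊆F x∈K) (x∉p-x K)) (p─q⊆p F (K - x)) (coloops x∈K)
      B-x≡F─K : B - x ≡ F ─ K
      B-x≡F─K = trans (p─q─r≡p─q∪r F (K - x) ⁅ x ⁆) (cong (F ─_) ([p-x]∪⁅x⁆≡p x∈K))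

  rank-cyc : ∀ F → r F ≡ r (cyc F) + ∣ F ─ cyc F ∣
  rank-cyc F = ℕₚ.≤-antisym
    (ℕₚ.≤-trans (r-mono (⊆-∪-─ F (cyc F))) (rank-∪-≤ (cyc F) (F ─ cyc F)))
    (subst (λ Z → r Z + ∣ F ─ cyc F ∣ ≤ r F) (p─[p─q]≡q cyc-⊆)
           (rank-─-coloops F (F ─ cyc F) (p─q⊆p F (cyc F))
              (λ e∈ → coloop-rank (p─q⊆p F (cyc F) e∈) (x∈p─q⇒x∉q F (cyc F) e∈))))

  cyc-cyclic : ∀ F → Cyclic M (cyc F)
  cyc-cyclic F e e∈ lt = ℕₚ.<-irrefl refl (begin-strict
    r F                                  ≡⟨ sym (proj₂ (∈-cyc⁻ e∈)) ⟩
    r (F - e)                            ≤⟨ r-mono F-e⊆ ⟩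
    r ((cyc F - e) ∪ (F ─ cyc F))        ≤⟨ rank-∪-≤ (cyc F - e) (F ─ cyc F) ⟩
    r (cyc F - e) + ∣ F ─ cyc F ∣        <⟨ ℕₚ.+-monoˡ-< ∣ F ─ cyc F ∣ lt ⟩
    r (cyc F) + ∣ F ─ cyc F ∣            ≡⟨ sym (rank-cyc F) ⟩
    r F                                  ∎)
    where
    open ℕₚ.≤-Reasoning
    F-e⊆ : F - e ⊆ (cyc F - e) ∪ (F ─ cyc F)
    F-e⊆ {y} y∈ with y ∈? cyc F
    ... | yes y∈C = x∈p∪q⁺ (inj₁ (x∈p∧x∉q⇒x∈p─q y∈C (x∈p─q⇒x∉q F ⁅ e ⁆ y∈)))
    ... | no y∉C = x∈p∪q⁺ (inj₂ (x∈p∧x∉q⇒x∈p─q (p─q⊆p F ⁅ e ⁆ y∈) y∉C))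

  cyc-greatest : ∀ {X F} → Cyclic M X → X ⊆ F → X ⊆ cyc F
  cyc-greatest {X} {F} X-cyclic X⊆F {e} e∈X = ∈-cyc⁺ (X⊆F e∈X)
    (ℕₚ.≤-antisym (r-mono (p─q⊆p F ⁅ e ⁆)) (ℕₚ.+-cancelʳ-≤ (r X) (r F) (r (F - e)) (begin
      r F + r X           ≤⟨ ℕₚ.+-monoʳ-≤ (r F) (ℕₚ.≮⇒≥ (X-cyclic e e∈X)) ⟩
      r F + r (X - e)     ≤⟨ exchange e∈X X⊆F ⟩
      r (F - e) + r X     ∎)))
    where open ℕₚ.≤-Reasoning

  cyc-of-cyclic : ∀ {X} → Cyclic M X → cyc X ≡ X
  cyc-of-cyclic X-cyclic = ⊆-antisym cyc-⊆ (cyc-greatest X-cyclic ⊆-refl)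

  cyc-flat : ∀ {F} → Flat M F → Flat M (cyc F)
  cyc-flat {F} F-flat e rank≡ with e ∈? cyc F
  ... | yes e∈C = e∈C
  ... | no e∉C = ⊥-elim (ℕₚ.<-irrefl refl (begin-strict
    r F                                      ≤⟨ r-mono F⊆ ⟩
    r ((cyc F ∪ ⁅ e ⁆) ∪ (K - e))            ≤⟨ rank-∪-≤ (cyc F ∪ ⁅ e ⁆) (K - e) ⟩
    r (cyc F ∪ ⁅ e ⁆) + ∣ K - e ∣            ≡⟨ cong (_+ ∣ K - e ∣) rank≡ ⟩
    r (cyc F) + ∣ K - e ∣                    <⟨ ℕₚ.+-monoʳ-< (r (cyc F)) (ℕₚ.≤-reflexive (∣p-x∣+1≡∣p∣ K e∈K)) ⟩
    r (cyc F) + ∣ K ∣                        ≡⟨ sym (rank-cyc F) ⟩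
    r F                                      ∎))
    where
    open ℕₚ.≤-Reasoning
    K = F ─ cyc F
    e∈K : e ∈ K
    e∈K = x∈p∧x∉q⇒x∈p─q (F-flat e (rank-∪-stable cyc-⊆ rank≡)) e∉C
    F⊆ : F ⊆ (cyc F ∪ ⁅ e ⁆) ∪ (K - e)
    F⊆ {y} y∈F with y ∈? cyc F | y Finₚ.≟ e
    ... | yes y∈C | _ = x∈p∪q⁺ (inj₁ (p⊆p∪q ⁅ e ⁆ y∈C))
    ... | no _ | yes refl = x∈p∪q⁺ (inj₁ (q⊆p∪q (cyc F) ⁅ e ⁆ (x∈⁅x⁆ e)))
    ... | no y∉C | no y≢e = x∈p∪q⁺ (inj₂ (x∈p∧x≢y⇒x∈p-y (x∈p∧x∉q⇒x∈p─q y∈F y∉C) y≢e))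

  cyclicFlatOf : Subset n → Subset n
  cyclicFlatOf S = cyc (cl S)

  cyclicFlatOf-cyclicFlat : ∀ S → CyclicFlat M (cyclicFlatOf S)
  cyclicFlatOf-cyclicFlat S = cyc-flat (cl-flat S) , cyc-cyclic (cl S)

  cyclicFlatOf-⊆ : ∀ {S F} → Flat M F → S ⊆ F → cyclicFlatOf S ⊆ F
  cyclicFlatOf-⊆ F-flat S⊆F = ⊆-trans cyc-⊆ (cl-least F-flat S⊆F)

  cyclicFlatOf-cyclicFlat≡ : ∀ {Z} → CyclicFlat M Z → cyclicFlatOf Z ≡ Z
  cyclicFlatOf-cyclicFlat≡ (Z-flat , Z-cyclic) = trans (cong cyc (cl-of-flat Z-flat)) (cyc-of-cyclic Z-cyclic)

  coloops-of-cl-⊆ : ∀ S → cl S ─ cyc (cl S) ⊆ S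
  coloops-of-cl-⊆ S {e} e∈ with e ∈? S
  ... | yes e∈S = e∈S
  ... | no e∉S = ⊥-elim (ℕₚ.<-irrefl refl (begin-strict
    r S             ≤⟨ r-mono S⊆F-e ⟩
    r (cl S - e)    <⟨ coloop-rank (p─q⊆p (cl S) _ e∈) (x∈p─q⇒x∉q (cl S) _ e∈) ⟩
    r (cl S)        ≡⟨ rank-cl S ⟩
    r S             ∎))
    where
    open ℕₚ.≤-Reasoning
    S⊆F-e : S ⊆ cl S - e
    S⊆F-e y∈S = x∈p∧x≢y⇒x∈p-y (⊆-cl y∈S) (λ { refl → e∉S y∈S })

  -- The bijection behind Rpoly-decomposition: for T ⊆ W and J disjoint from W,
  -- W = cyclicFlatOf (T ∪ J) exactly when cyclicFlatOf (W ∪ J) = W and r T = r W.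
  cyclicFlatOf-∪⁻ : ∀ {X T W J} → Cyclic M X → T ⊆ W → (∀ {x} → x ∈ J → x ∉ W) →
                    W ≡ cyclicFlatOf (T ∪ J) → X ⊆ T ∪ J →
                    cyclicFlatOf (W ∪ J) ≡ W × X ⊆ T × r T ≡ r W
  cyclicFlatOf-∪⁻ {X} {T} {_} {J} X-cyclic T⊆W J∉W refl X⊆S =
    cyclicFlatOf-W∪J , X⊆T , ℕₚ.≤-antisym (r-mono T⊆W) (ℕₚ.+-cancelʳ-≤ ∣ J ∣ _ _ rW+∣J∣≤)
    where
    S = T ∪ J
    F = cl S
    W = cyc F
    J⊆F─W : J ⊆ F ─ W
    J⊆F─W y∈J = x∈p∧x∉q⇒x∈p─q (⊆-cl (q⊆p∪q T J y∈J)) (J∉W y∈J)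
    F─W⊆J : F ─ W ⊆ J
    F─W⊆J y∈ with x∈p∪q⁻ T J (coloops-of-cl-⊆ S y∈)
    ... | inj₁ y∈T = ⊥-elim (x∈p─q⇒x∉q F W y∈ (T⊆W y∈T))
    ... | inj₂ y∈J = y∈J
    J≡F─W : J ≡ F ─ W
    J≡F─W = ⊆-antisym J⊆F─W F─W⊆J
    W∪J≡F : W ∪ J ≡ F
    W∪J≡F = ⊆-antisym (∪-⊆ cyc-⊆ (⊆-trans J⊆F─W (p─q⊆p F W)))
                      (subst (λ Z → F ⊆ W ∪ Z) (sym J≡F─W) (⊆-∪-─ F W))
    cyclicFlatOf-W∪J : cyc (cl (W ∪ J)) ≡ W
    cyclicFlatOf-W∪J = trans (cong (cyc ∘ cl) W∪J≡F) (cong cyc (cl-of-flat (cl-flat S)))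
    X⊆T : X ⊆ T
    X⊆T y∈X with x∈p∪q⁻ T J (X⊆S y∈X)
    ... | inj₁ y∈T = y∈T
    ... | inj₂ y∈J = ⊥-elim (J∉W y∈J (cyc-greatest X-cyclic (⊆-trans X⊆S ⊆-cl) y∈X))
    rW+∣J∣≤ : r W + ∣ J ∣ ≤ r T + ∣ J ∣
    rW+∣J∣≤ = begin
      r W + ∣ J ∣         ≡⟨ cong (λ Z → r W + ∣ Z ∣) J≡F─W ⟩
      r W + ∣ F ─ W ∣     ≡⟨ sym (rank-cyc F) ⟩
      r F                 ≡⟨ rank-cl S ⟩
      r S                 ≤⟨ rank-∪-≤ T J ⟩
      r T + ∣ J ∣         ∎
      where open ℕₚ.≤-Reasoning

  cyclicFlatOf-∪⁺ : ∀ {T W J} → T ⊆ W → (∀ {x} → x ∈ J → x ∉ W) →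
                    cyclicFlatOf (W ∪ J) ≡ W → r T ≡ r W →
                    W ≡ cyclicFlatOf (T ∪ J) × r (T ∪ J) ≡ r (W ∪ J) × r (W ∪ J) ≡ r W + ∣ J ∣
  cyclicFlatOf-∪⁺ {T} {W} {J} T⊆W J∉W W-of-W∪J rT≡rW =
    sym (trans (cong cyc (cl-cong T∪J⊆W∪J rT∪J≡rW∪J)) W-of-W∪J) ,
    rT∪J≡rW∪J , ℕₚ.≤-antisym (rank-∪-≤ W J) rW+∣J∣≤
    where
    T∪J⊆W∪J : T ∪ J ⊆ W ∪ J
    T∪J⊆W∪J = ∪-mono T⊆W ⊆-refl
    rT∪J≡rW∪J : r (T ∪ J) ≡ r (W ∪ J)
    rT∪J≡rW∪J = ℕₚ.≤-antisym (r-mono T∪J⊆W∪J) (begin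
      r (W ∪ J)             ≤⟨ r-mono (∪-⊆ (q⊆p∪q (T ∪ J) W) (⊆-trans (q⊆p∪q T J) (p⊆p∪q W))) ⟩
      r ((T ∪ J) ∪ W)       ≡⟨ rank-∪-stable (p⊆p∪q J) (trans (cong r T∪W≡W) (sym rT≡rW)) ⟩
      r (T ∪ J)             ∎)
      where
      open ℕₚ.≤-Reasoning
      T∪W≡W : T ∪ W ≡ W
      T∪W≡W = ⊆-antisym (∪-⊆ T⊆W ⊆-refl) (q⊆p∪q T W)
    F = cl (W ∪ J)
    J⊆F─cycF : J ⊆ F ─ cyc F
    J⊆F─cycF y∈J = x∈p∧x∉q⇒x∈p─q (⊆-cl (q⊆p∪q W J y∈J)) (subst (_ ∉_) (sym W-of-W∪J) (J∉W y∈J))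
    rW+∣J∣≤ : r W + ∣ J ∣ ≤ r (W ∪ J)
    rW+∣J∣≤ = begin
      r W + ∣ J ∣               ≤⟨ ℕₚ.+-monoʳ-≤ (r W) (p⊆q⇒∣p∣≤∣q∣ J⊆F─cycF) ⟩
      r W + ∣ F ─ cyc F ∣       ≡⟨ cong (_+ ∣ F ─ cyc F ∣) (cong r (sym W-of-W∪J)) ⟩
      r (cyc F) + ∣ F ─ cyc F ∣ ≡⟨ sym (rank-cyc F) ⟩
      r F                       ≡⟨ rank-cl (W ∪ J) ⟩
      r (W ∪ J)                 ∎
      where open ℕₚ.≤-Reasoning

module IntervalPolynomials {n : ℕ} (M : Matroid n) where

  open import Defs using (Poly; 0ₚ; 1ₚ; _⊗_; coeff; allSubsets; rankGenPoly)
  open ListSums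
  open Polynomials
  open Subsets
  open MatroidClosure M
  open import Data.Bool using (if_then_else_)
  open import Data.Nat using (_+_; _∸_; _≤_; _≟_)
  import Data.Nat.Properties as ℕₚ
  open import Data.Integer using (ℤ; +_)
  open import Data.Fin.Subset using (Subset; _∈_; _∉_; _⊆_; _∪_; _∩_; _─_; ∣_∣; ⊤; ⊥)
  open import Data.Fin.Subset.Properties using (∣⊥∣≡0; _⊆?_; ⊆-refl; ⊆-trans; ⊆-antisym; ⊆-min; p⊆p∪q; p∩q⊆q; p─q⊆p; p⊆q⇒∣p∣≤∣q∣; ∪-identityʳ)
  open import Data.List using (filterᵇ)
  open import Data.Product using (_×_; _,_; proj₁)
  open import Data.Empty using (⊥-elim)
  open import Function using (_∘_)
  open import Relation.Binary.PropositionalEquality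
  open import Relation.Nullary using (¬_; Dec; yes; no; does)
  open import Relation.Nullary.Decidable using (_×-dec_)

  open Matroid M renaming (rank to r)

  Rpoly : Subset n → Subset n → Poly
  Rpoly X Y = genPoly (filterᵇ (does ∘ (X ⊆?_)) (subsetsOf Y))
                      (λ S → r Y ∸ r S) (λ S → (∣ S ∣ ∸ ∣ X ∣) ∸ (r S ∸ r X))

  Cterm? : (W Y J : Subset n) → Dec (W ⊆ Y × cyclicFlatOf (W ∪ J) ≡ W)
  Cterm? W Y J = (W ⊆? Y) ×-dec (cyclicFlatOf (W ∪ J) ≟ₛ W)

  Cpoly : Subset n → Subset n → Poly
  Cpoly W Y = genPoly (filterᵇ (does ∘ Cterm? W Y) (subsetsOf (Y ─ W))) (λ J → r Y ∸ r (W ∪ J)) (λ _ → 0)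

  Fterm? : (X W T : Subset n) → Dec (X ⊆ T × r T ≡ r W)
  Fterm? X W T = (X ⊆? T) ×-dec (r T ≟ r W)

  Fpoly : Subset n → Subset n → Poly
  Fpoly X W = genPoly (filterᵇ (does ∘ Fterm? X W) (subsetsOf W)) (λ _ → 0) (λ T → (∣ T ∣ ∸ ∣ X ∣) ∸ (r W ∸ r X))

  [t+k∸x]∸[w+k∸y]≡[t∸x]∸[w∸y] : ∀ t k {x w y} → x ≤ t → y ≤ w → (t + k ∸ x) ∸ (w + k ∸ y) ≡ (t ∸ x) ∸ (w ∸ y)
  [t+k∸x]∸[w+k∸y]≡[t∸x]∸[w∸y] t k {x} {w} {y} x≤t y≤w = begin
    (t + k ∸ x) ∸ (w + k ∸ y)       ≡⟨ cong₂ _∸_ (ℕₚ.+-∸-comm k x≤t) (ℕₚ.+-∸-comm k y≤w) ⟩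
    (t ∸ x + k) ∸ (w ∸ y + k)       ≡⟨ cong₂ _∸_ (ℕₚ.+-comm (t ∸ x) k) (ℕₚ.+-comm (w ∸ y) k) ⟩
    (k + (t ∸ x)) ∸ (k + (w ∸ y))   ≡⟨ ℕₚ.[m+n]∸[m+o]≡n∸o k (t ∸ x) (w ∸ y) ⟩
    (t ∸ x) ∸ (w ∸ y)               ∎
    where open ≡-Reasoning

  Cpoly-⊈ : ∀ {W Y} → ¬ W ⊆ Y → Cpoly W Y ≈ 0ₚ
  Cpoly-⊈ {W} {Y} W⊈Y i j = trans (coeff-genPoly-filterᵇ _ (subsetsOf (Y ─ W)) _ _ i j)
    (∑-zero-∈ (subsetsOf (Y ─ W)) (λ J _ → if-no (Cterm? W Y J) (W⊈Y ∘ proj₁)))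

  module _ (X Y : Subset n) (i j : ℕ) where

    Rterm : Subset n → ℤ
    Rterm S = if does (X ⊆? S) then monoCoeff (r Y ∸ r S) ((∣ S ∣ ∸ ∣ X ∣) ∸ (r S ∸ r X)) i j else + 0

    coeff-Rpoly : coeff (Rpoly X Y) i j ≡ ∑ (subsetsOf Y) Rterm
    coeff-Rpoly = coeff-genPoly-filterᵇ _ (subsetsOf Y) _ _ i j

    module _ (W : Subset n) where

      CFterm : Subset n → Subset n → ℤ
      CFterm J T = if does (Cterm? W Y J ×-dec Fterm? X W T)
                   then monoCoeff (r Y ∸ r (W ∪ J) + 0) (0 + ((∣ T ∣ ∸ ∣ X ∣) ∸ (r W ∸ r X))) i j
                   else + 0

      coeff-Cpoly-⊗-Fpoly : coeff (Cpoly W Y ⊗ Fpoly X W) i j ≡ ∑ (subsetsOf (Y ─ W)) (λ J → ∑ (subsetsOf W) (CFterm J))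
      coeff-Cpoly-⊗-Fpoly = begin
        coeff (Cpoly W Y ⊗ Fpoly X W) i j
          ≡⟨ coeff-genPoly-⊗ (filterᵇ (does ∘ Cterm? W Y) (subsetsOf (Y ─ W))) _ _
                             (filterᵇ (does ∘ Fterm? X W) (subsetsOf W)) _ _ i j ⟩
        ∑ (filterᵇ _ (subsetsOf (Y ─ W))) (λ J → ∑ (filterᵇ _ (subsetsOf W)) (λ T → mono J T))
          ≡⟨ ∑-filterᵇ _ (subsetsOf (Y ─ W)) _ ⟩
        ∑ (subsetsOf (Y ─ W)) (λ J → if does (Cterm? W Y J) then ∑ (filterᵇ _ (subsetsOf W)) (mono J) else + 0)
          ≡⟨ ∑-cong (subsetsOf (Y ─ W)) (λ J → cong (λ z → if does (Cterm? W Y J) then z else + 0)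
                                                     (∑-filterᵇ (does ∘ Fterm? X W) (subsetsOf W) (mono J))) ⟩
        ∑ (subsetsOf (Y ─ W)) (λ J → if does (Cterm? W Y J)
                                       then ∑ (subsetsOf W) (λ T → if does (Fterm? X W T) then mono J T else + 0)
                                       else + 0)
          ≡⟨ ∑-cong (subsetsOf (Y ─ W)) (λ J → sym (∑-if (does (Cterm? W Y J)) (subsetsOf W) _)) ⟩
        ∑ (subsetsOf (Y ─ W)) (λ J → ∑ (subsetsOf W) (λ T →
            if does (Cterm? W Y J) then (if does (Fterm? X W T) then mono J T else + 0) else + 0))
          ≡⟨ ∑-cong (subsetsOf (Y ─ W)) (λ J → ∑-cong (subsetsOf W) (λ T → if-∧ (does (Cterm? W Y J)) (does (Fterm? X W T)) (mono J T))) ⟩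
        ∑ (subsetsOf (Y ─ W)) (λ J → ∑ (subsetsOf W) (CFterm J))
          ∎
        where
        open ≡-Reasoning
        mono : Subset n → Subset n → ℤ
        mono J T = monoCoeff (r Y ∸ r (W ∪ J) + 0) (0 + ((∣ T ∣ ∸ ∣ X ∣) ∸ (r W ∸ r X))) i j

      Rterm-split : Cyclic M X → W ⊆ Y → ∀ {T J} → T ⊆ W → J ⊆ Y ─ W →
                    (if does (W ≟ₛ cyclicFlatOf (T ∪ J)) then Rterm (T ∪ J) else + 0) ≡ CFterm J T
      Rterm-split X-cyclic W⊆Y {T} {J} T⊆W J⊆Y─W =
        trans (if-∧ (does (W ≟ₛ cyclicFlatOf (T ∪ J))) (does (X ⊆? T ∪ J)) _)
              (if-does-cong ((W ≟ₛ cyclicFlatOf (T ∪ J)) ×-dec (X ⊆? T ∪ J)) (Cterm? W Y J ×-dec Fterm? X W T)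
                            to from exponents)
        where
        J∉W : ∀ {x} → x ∈ J → x ∉ W
        J∉W x∈J = x∈p─q⇒x∉q Y W (J⊆Y─W x∈J)
        to : W ≡ cyclicFlatOf (T ∪ J) × X ⊆ T ∪ J → (W ⊆ Y × cyclicFlatOf (W ∪ J) ≡ W) × (X ⊆ T × r T ≡ r W)
        to (W≡ , X⊆T∪J) with cyclicFlatOf-∪⁻ X-cyclic T⊆W J∉W W≡ X⊆T∪J
        ... | W-of-W∪J , X⊆T , rT≡rW = (W⊆Y , W-of-W∪J) , (X⊆T , rT≡rW)
        from : (W ⊆ Y × cyclicFlatOf (W ∪ J) ≡ W) × (X ⊆ T × r T ≡ r W) → W ≡ cyclicFlatOf (T ∪ J) × X ⊆ T ∪ J
        from ((_ , W-of-W∪J) , (X⊆T , rT≡rW)) =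
          proj₁ (cyclicFlatOf-∪⁺ T⊆W J∉W W-of-W∪J rT≡rW) , ⊆-trans X⊆T (p⊆p∪q J)
        exponents : W ≡ cyclicFlatOf (T ∪ J) × X ⊆ T ∪ J →
                    monoCoeff (r Y ∸ r (T ∪ J)) ((∣ T ∪ J ∣ ∸ ∣ X ∣) ∸ (r (T ∪ J) ∸ r X)) i j
                    ≡ monoCoeff (r Y ∸ r (W ∪ J) + 0) (0 + ((∣ T ∣ ∸ ∣ X ∣) ∸ (r W ∸ r X))) i j
        exponents P with to P
        ... | (_ , W-of-W∪J) , (X⊆T , rT≡rW) with cyclicFlatOf-∪⁺ T⊆W J∉W W-of-W∪J rT≡rW
        ...   | _ , rT∪J≡rW∪J , rW∪J≡rW+∣J∣ = cong₂ (λ a b → monoCoeff a b i j)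
          (trans (cong (r Y ∸_) rT∪J≡rW∪J) (sym (ℕₚ.+-identityʳ _)))
          (trans (cong₂ (λ s t → (s ∸ ∣ X ∣) ∸ (t ∸ r X)) ∣T∪J∣ (trans rT∪J≡rW∪J rW∪J≡rW+∣J∣))
                 ([t+k∸x]∸[w+k∸y]≡[t∸x]∸[w∸y] ∣ T ∣ ∣ J ∣ (p⊆q⇒∣p∣≤∣q∣ X⊆T) (r-mono (⊆-trans X⊆T T⊆W))))
          where
          ∣T∪J∣ : ∣ T ∪ J ∣ ≡ ∣ T ∣ + ∣ J ∣
          ∣T∪J∣ = ∣p∪q∣≡∣p∣+∣q∣ T J (λ x∈T x∈J → J∉W x∈J (T⊆W x∈T))

      Rterm-fibre : Cyclic M X → Flat M Y →
                    ∑ (subsetsOf Y) (λ S → if does (W ≟ₛ cyclicFlatOf S) then Rterm S else + 0)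
                    ≡ coeff (Cpoly W Y ⊗ Fpoly X W) i j
      Rterm-fibre X-cyclic Y-flat = fibre (W ⊆? Y)
        where
        g : Subset n → ℤ
        g S = if does (W ≟ₛ cyclicFlatOf S) then Rterm S else + 0
        fibre : Dec (W ⊆ Y) → ∑ (subsetsOf Y) g ≡ coeff (Cpoly W Y ⊗ Fpoly X W) i j
        fibre (no W⊈Y) = trans
          (∑-subsetsOf-zero Y (λ S S⊆Y → if-no (W ≟ₛ cyclicFlatOf S)
                                            (λ W≡ → W⊈Y (subst (_⊆ Y) (sym W≡) (cyclicFlatOf-⊆ Y-flat S⊆Y)))))
          (sym (⊗-congˡ {Cpoly W Y} {0ₚ} (Fpoly X W) (Cpoly-⊈ W⊈Y) i j))
        fibre (yes W⊆Y) = begin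
          ∑ (subsetsOf Y) g
            ≡⟨ ∑-subsetsOf-split Y W g ⟩
          ∑ (subsetsOf (Y ∩ W)) (λ T → ∑ (subsetsOf (Y ─ W)) (λ J → g (T ∪ J)))
            ≡⟨ cong (λ Z → ∑ (subsetsOf Z) (λ T → ∑ (subsetsOf (Y ─ W)) (λ J → g (T ∪ J)))) Y∩W≡W ⟩
          ∑ (subsetsOf W) (λ T → ∑ (subsetsOf (Y ─ W)) (λ J → g (T ∪ J)))
            ≡⟨ ∑-comm (subsetsOf W) (subsetsOf (Y ─ W)) (λ T J → g (T ∪ J)) ⟩
          ∑ (subsetsOf (Y ─ W)) (λ J → ∑ (subsetsOf W) (λ T → g (T ∪ J)))
            ≡⟨ ∑-subsetsOf-cong (Y ─ W) (λ J J⊆ → ∑-subsetsOf-cong W (λ T T⊆W → Rterm-split X-cyclic W⊆Y T⊆W J⊆)) ⟩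
          ∑ (subsetsOf (Y ─ W)) (λ J → ∑ (subsetsOf W) (CFterm J))
            ≡⟨ sym coeff-Cpoly-⊗-Fpoly ⟩
          coeff (Cpoly W Y ⊗ Fpoly X W) i j
            ∎
          where
          open ≡-Reasoning
          Y∩W≡W : Y ∩ W ≡ W
          Y∩W≡W = ⊆-antisym (p∩q⊆q Y W) (⊆-∩ W⊆Y ⊆-refl)

    -- sort the S ⊆ Y by their cyclic flat W = cyclicFlatOf S
    Rpoly-decomposition : Cyclic M X → Flat M Y →
                          coeff (Rpoly X Y) i j ≡ ∑ (allSubsets n) (λ W → coeff (Cpoly W Y ⊗ Fpoly X W) i j)
    Rpoly-decomposition X-cyclic Y-flat = begin
      coeff (Rpoly X Y) i j
        ≡⟨ coeff-Rpoly ⟩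
      ∑ (subsetsOf Y) Rterm
        ≡⟨ ∑-cong (subsetsOf Y) (λ S → sym (∑-allSubsets-≟ₛ (cyclicFlatOf S) (λ _ → Rterm S))) ⟩
      ∑ (subsetsOf Y) (λ S → ∑ (allSubsets n) (λ W → if does (W ≟ₛ cyclicFlatOf S) then Rterm S else + 0))
        ≡⟨ ∑-comm (subsetsOf Y) (allSubsets n) _ ⟩
      ∑ (allSubsets n) (λ W → ∑ (subsetsOf Y) (λ S → if does (W ≟ₛ cyclicFlatOf S) then Rterm S else + 0))
        ≡⟨ ∑-cong (allSubsets n) (λ W → Rterm-fibre W X-cyclic Y-flat) ⟩
      ∑ (allSubsets n) (λ W → coeff (Cpoly W Y ⊗ Fpoly X W) i j)
        ∎
      where open ≡-Reasoning

  Cpoly-nonCyclicFlat : ∀ {W Y} → ¬ CyclicFlat M W → Cpoly W Y ≈ 0ₚ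
  Cpoly-nonCyclicFlat {W} {Y} W-not i j = trans (coeff-genPoly-filterᵇ _ (subsetsOf (Y ─ W)) _ _ i j)
    (∑-zero-∈ (subsetsOf (Y ─ W)) (λ J _ → if-no (Cterm? W Y J)
      (λ (_ , W-of-W∪J) → W-not (subst (CyclicFlat M) W-of-W∪J (cyclicFlatOf-cyclicFlat (W ∪ J))))))

  Fpoly-⊈ : ∀ {X W} → ¬ X ⊆ W → Fpoly X W ≈ 0ₚ
  Fpoly-⊈ {X} {W} X⊈W i j = trans (coeff-genPoly-filterᵇ _ (subsetsOf W) _ _ i j)
    (∑-subsetsOf-zero W (λ T T⊆W → if-no (Fterm? X W T) (λ (X⊆T , _) → X⊈W (⊆-trans X⊆T T⊆W))))

  Rpoly-⊈ : ∀ {X Y} → ¬ X ⊆ Y → Rpoly X Y ≈ 0ₚ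
  Rpoly-⊈ {X} {Y} X⊈Y i j = trans (coeff-Rpoly X Y i j)
    (∑-subsetsOf-zero Y (λ S S⊆Y → if-no (X ⊆? S) (λ X⊆S → X⊈Y (⊆-trans X⊆S S⊆Y))))

  Fpoly-refl : ∀ W → Fpoly W W ≈ 1ₚ
  Fpoly-refl W i j = begin
    coeff (Fpoly W W) i j
      ≡⟨ coeff-genPoly-filterᵇ _ (subsetsOf W) _ _ i j ⟩
    ∑ (subsetsOf W) (λ T → if does (Fterm? W W T) then monoCoeff 0 ((∣ T ∣ ∸ ∣ W ∣) ∸ (r W ∸ r W)) i j else + 0)
      ≡⟨ ∑-subsetsOf-single W _ ⊆-refl (λ T T⊆W T≢W → if-no (Fterm? W W T) (λ (W⊆T , _) → T≢W (⊆-antisym T⊆W W⊆T))) ⟩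
    (if does (Fterm? W W W) then monoCoeff 0 ((∣ W ∣ ∸ ∣ W ∣) ∸ (r W ∸ r W)) i j else + 0)
      ≡⟨ if-yes (Fterm? W W W) (⊆-refl , refl) ⟩
    monoCoeff 0 ((∣ W ∣ ∸ ∣ W ∣) ∸ (r W ∸ r W)) i j
      ≡⟨ cong₂ (λ s t → monoCoeff 0 (s ∸ t) i j) (ℕₚ.n∸n≡0 ∣ W ∣) (ℕₚ.n∸n≡0 (r W)) ⟩
    monoCoeff 0 0 i j
      ≡⟨ sym (coeff-1ₚ i j) ⟩
    coeff 1ₚ i j
      ∎
    where open ≡-Reasoning

  Cpoly-refl : ∀ {Y} → CyclicFlat M Y → Cpoly Y Y ≈ 1ₚ
  Cpoly-refl {Y} Y-cf i j = begin
    coeff (Cpoly Y Y) i j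
      ≡⟨ coeff-genPoly-filterᵇ _ (subsetsOf (Y ─ Y)) _ _ i j ⟩
    ∑ (subsetsOf (Y ─ Y)) (λ J → if does (Cterm? Y Y J) then monoCoeff (r Y ∸ r (Y ∪ J)) 0 i j else + 0)
      ≡⟨ ∑-subsetsOf-single (Y ─ Y) _ (⊆-min (Y ─ Y)) (λ J J⊆ J≢⊥ → ⊥-elim (J≢⊥ (empty J⊆))) ⟩
    (if does (Cterm? Y Y ⊥) then monoCoeff (r Y ∸ r (Y ∪ ⊥)) 0 i j else + 0)
      ≡⟨ if-yes (Cterm? Y Y ⊥) (⊆-refl , trans (cong cyclicFlatOf (∪-identityʳ Y)) (cyclicFlatOf-cyclicFlat≡ Y-cf)) ⟩
    monoCoeff (r Y ∸ r (Y ∪ ⊥)) 0 i j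
      ≡⟨ cong (λ e → monoCoeff e 0 i j) (trans (cong (λ Z → r Y ∸ r Z) (∪-identityʳ Y)) (ℕₚ.n∸n≡0 (r Y))) ⟩
    monoCoeff 0 0 i j
      ≡⟨ sym (coeff-1ₚ i j) ⟩
    coeff 1ₚ i j
      ∎
    where
    open ≡-Reasoning
    empty : ∀ {J} → J ⊆ Y ─ Y → J ≡ ⊥
    empty J⊆ = ⊆-antisym (λ x∈J → ⊥-elim (x∈p─q⇒x∉q Y Y (J⊆ x∈J) (p─q⊆p Y Y (J⊆ x∈J)))) (⊆-min _)

  rankGenPoly≈Rpoly : rankGenPoly M ≈ Rpoly ⊥ ⊤
  rankGenPoly≈Rpoly i j = begin
    coeff (rankGenPoly M) i j
      ≡⟨ coeff-genPoly (allSubsets n) _ _ i j ⟩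
    ∑ (allSubsets n) (λ S → monoCoeff (r ⊤ ∸ r S) (∣ S ∣ ∸ r S) i j)
      ≡⟨ cong (λ Ss → ∑ Ss (λ S → monoCoeff (r ⊤ ∸ r S) (∣ S ∣ ∸ r S) i j)) (sym (subsetsOf-⊤ n)) ⟩
    ∑ (subsetsOf ⊤) (λ S → monoCoeff (r ⊤ ∸ r S) (∣ S ∣ ∸ r S) i j)
      ≡⟨ ∑-cong (subsetsOf ⊤) (λ S → sym (from-⊥ S)) ⟩
    ∑ (subsetsOf ⊤) (Rterm ⊥ ⊤ i j)
      ≡⟨ sym (coeff-Rpoly ⊥ ⊤ i j) ⟩
    coeff (Rpoly ⊥ ⊤) i j
      ∎
    where
    open ≡-Reasoning
    from-⊥ : ∀ S → Rterm ⊥ ⊤ i j S ≡ monoCoeff (r ⊤ ∸ r S) (∣ S ∣ ∸ r S) i j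
    from-⊥ S = trans (if-yes (⊥ ⊆? S) (⊆-min S))
      (cong₂ (λ a b → monoCoeff (r ⊤ ∸ r S) ((∣ S ∣ ∸ a) ∸ (r S ∸ b)) i j) (∣⊥∣≡0 n) rank-⊥)

module Truncations {n : ℕ} (M : Matroid n) where

  open import Defs using (0ₚ; coeff; δx; δy; bx; by)
  open ListSums
  open Polynomials
  open Subsets
  open MatroidClosure M
  open IntervalPolynomials M
  open import Data.Bool using (if_then_else_)
  open import Data.Nat using (suc; _+_; _∸_; _≤_; _<_; s≤s)
  import Data.Nat.Properties as ℕₚ
  open import Data.Nat.Combinatorics using (_C_)
  open import Data.Integer using (+_) renaming (_*_ to _*ℤ_)
  open import Data.Fin.Subset using (Subset; _⊆_; _∪_; _─_; ∣_∣)
  open import Data.Fin.Subset.Properties using (_⊆?_; ⊆-trans; p─q⊆p; p⊆q⇒∣p∣≤∣q∣)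
  open import Data.List using (upTo; filterᵇ)
  open import Data.Product using (_×_; _,_)
  open import Function using (id; _∘_)
  open import Relation.Binary.PropositionalEquality
  open import Relation.Nullary using (does)

  open Matroid M renaming (rank to r)

  Cpoly-degree-pos : ∀ {W Y J} → CyclicFlat M Y → W ≢ Y → J ⊆ Y ─ W →
                     W ⊆ Y × cyclicFlatOf (W ∪ J) ≡ W → 0 < r Y ∸ r (W ∪ J)
  Cpoly-degree-pos {W} {Y} {J} Y-cf W≢Y J⊆ (W⊆Y , W-of-W∪J) =
    ℕₚ.m<n⇒0<n∸m (ℕₚ.≤∧≢⇒< (r-mono W∪J⊆Y) (λ rW∪J≡rY → W≢Y (begin
      W                       ≡⟨ sym W-of-W∪J ⟩
      cyc (cl (W ∪ J))        ≡⟨ cong cyc (cl-cong W∪J⊆Y rW∪J≡rY) ⟩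
      cyclicFlatOf Y          ≡⟨ cyclicFlatOf-cyclicFlat≡ Y-cf ⟩
      Y                       ∎)))
    where
    open ≡-Reasoning
    W∪J⊆Y : W ∪ J ⊆ Y
    W∪J⊆Y = ∪-⊆ W⊆Y (⊆-trans J⊆ (p─q⊆p Y W))

  module _ {W Y : Subset n} (Y-cf : CyclicFlat M Y) (W≢Y : W ≢ Y) where

    Cpoly-δx : δx (Cpoly W Y) ≈ Cpoly W Y
    Cpoly-δx i j = begin
      coeff (δx (Cpoly W Y)) i j
        ≡⟨ coeff-δx (Cpoly W Y) i j ⟩
      linExt (truncX i j) (Cpoly W Y)
        ≡⟨ linExt-genPoly-filterᵇ (truncX i j) _ (subsetsOf (Y ─ W)) _ _ ⟩
      ∑ (subsetsOf (Y ─ W)) (λ J → if does (Cterm? W Y J) then truncX i j (r Y ∸ r (W ∪ J)) 0 else + 0)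
        ≡⟨ ∑-subsetsOf-cong (Y ─ W) (λ J J⊆ → if-does-cong (Cterm? W Y J) (Cterm? W Y J) id id
                                                (λ c → truncX-pos i j (Cpoly-degree-pos Y-cf W≢Y J⊆ c))) ⟩
      ∑ (subsetsOf (Y ─ W)) (λ J → if does (Cterm? W Y J) then monoCoeff (r Y ∸ r (W ∪ J)) 0 i j else + 0)
        ≡⟨ sym (coeff-genPoly-filterᵇ _ (subsetsOf (Y ─ W)) _ _ i j) ⟩
      coeff (Cpoly W Y) i j
        ∎
      where open ≡-Reasoning

    Cpoly-δy : δy (Cpoly W Y) ≈ 0ₚ
    Cpoly-δy i j = begin
      coeff (δy (Cpoly W Y)) i j
        ≡⟨ coeff-δy (Cpoly W Y) i j ⟩
      linExt (truncY i j) (Cpoly W Y)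
        ≡⟨ linExt-genPoly-filterᵇ (truncY i j) _ (subsetsOf (Y ─ W)) _ _ ⟩
      ∑ (subsetsOf (Y ─ W)) (λ J → if does (Cterm? W Y J) then truncY i j (r Y ∸ r (W ∪ J)) 0 else + 0)
        ≡⟨ ∑-subsetsOf-zero (Y ─ W) (λ J J⊆ → if-does-zero (Cterm? W Y J)
                                                (λ c → truncY-pos i j (Cpoly-degree-pos Y-cf W≢Y J⊆ c))) ⟩
      + 0
        ∎
      where open ≡-Reasoning

  Fpoly-δx : ∀ X W → δx (Fpoly X W) ≈ 0ₚ
  Fpoly-δx X W i j = trans (coeff-δx (Fpoly X W) i j)
    (trans (linExt-genPoly (truncX i j) Ts _ _) (∑-zero Ts))
    where Ts = filterᵇ (does ∘ Fterm? X W) (subsetsOf W)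

  Fpoly-δy : ∀ X W → δy (Fpoly X W) ≈ Fpoly X W
  Fpoly-δy X W i j = trans (coeff-δy (Fpoly X W) i j)
    (trans (linExt-genPoly (truncY i j) Ts _ _) (sym (coeff-genPoly Ts _ _ i j)))
    where Ts = filterᵇ (does ∘ Fterm? X W) (subsetsOf W)

  module _ {X Y : Subset n} (X⊆Y : X ⊆ Y) (pos : 0 < ∣ Y ∣ ∸ ∣ X ∣) where

    private
      R = r Y ∸ r X
      m = ∣ Y ∣ ∸ ∣ X ∣

    -- δx and δy only see the difference of the exponents, so both may be lowered by r S - r X
    shifted-exponents : ∀ {S} → X ⊆ S → S ⊆ Y →
      (r Y ∸ r S ≡ R ∸ (r S ∸ r X)) × (r S ∸ r X ≤ R) × (r S ∸ r X ≤ ∣ S ∣ ∸ ∣ X ∣)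
    shifted-exponents {S} X⊆S S⊆Y =
      sym (trans (ℕₚ.∸-+-assoc (r Y) (r X) (r S ∸ r X)) (cong (r Y ∸_) (ℕₚ.m+[n∸m]≡n (r-mono X⊆S)))) ,
      ℕₚ.∸-monoˡ-≤ (r X) (r-mono S⊆Y) ,
      rank-∸-≤-card-∸ X⊆S

    Rpoly-δx : δx (Rpoly X Y) ≈ bx m R
    Rpoly-δx i j = begin
      coeff (δx (Rpoly X Y)) i j
        ≡⟨ coeff-δx (Rpoly X Y) i j ⟩
      linExt (truncX i j) (Rpoly X Y)
        ≡⟨ linExt-genPoly-filterᵇ (truncX i j) _ (subsetsOf Y) _ _ ⟩
      ∑ (subsetsOf Y) (λ S → if does (X ⊆? S) then truncX i j (r Y ∸ r S) ((∣ S ∣ ∸ ∣ X ∣) ∸ (r S ∸ r X)) else + 0)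
        ≡⟨ ∑-subsetsOf-cong Y (λ S S⊆Y → if-does-cong (X ⊆? S) (X ⊆? S) id id (λ X⊆S → by-size X⊆S S⊆Y)) ⟩
      ∑ (subsetsOf Y) (λ S → if does (X ⊆? S)
                               then ∑ (upTo R) (λ t → kron t (∣ S ∣ ∸ ∣ X ∣) *ℤ monoCoeff (R ∸ t) 0 i j) else + 0)
        ≡⟨ ∑-subsetsOf-sizes X Y X⊆Y (upTo R) id (λ t → monoCoeff (R ∸ t) 0 i j) ⟩
      ∑ (upTo R) (λ t → + (m C t) *ℤ monoCoeff (R ∸ t) 0 i j)
        ≡⟨ sym (coeff-bx m R i j pos) ⟩
      coeff (bx m R) i j
        ∎
      where
      open ≡-Reasoning
      by-size : ∀ {S} → X ⊆ S → S ⊆ Y →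
                truncX i j (r Y ∸ r S) ((∣ S ∣ ∸ ∣ X ∣) ∸ (r S ∸ r X))
                ≡ ∑ (upTo R) (λ t → kron t (∣ S ∣ ∸ ∣ X ∣) *ℤ monoCoeff (R ∸ t) 0 i j)
      by-size {S} X⊆S S⊆Y with shifted-exponents X⊆S S⊆Y
      ... | rY∸rS , q≤R , q≤u = trans (cong (λ a → truncX i j a ((∣ S ∣ ∸ ∣ X ∣) ∸ (r S ∸ r X))) rY∸rS)
        (trans (truncX-∸ i j q≤R q≤u) (sym (∑-upTo-kron R (∣ S ∣ ∸ ∣ X ∣) (λ t → monoCoeff (R ∸ t) 0 i j))))

    Rpoly-δy : δy (Rpoly X Y) ≈ by m R
    Rpoly-δy i j = begin
      coeff (δy (Rpoly X Y)) i j
        ≡⟨ coeff-δy (Rpoly X Y) i j ⟩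
      linExt (truncY i j) (Rpoly X Y)
        ≡⟨ linExt-genPoly-filterᵇ (truncY i j) _ (subsetsOf Y) _ _ ⟩
      ∑ (subsetsOf Y) (λ S → if does (X ⊆? S) then truncY i j (r Y ∸ r S) ((∣ S ∣ ∸ ∣ X ∣) ∸ (r S ∸ r X)) else + 0)
        ≡⟨ ∑-subsetsOf-cong Y (λ S S⊆Y → if-does-cong (X ⊆? S) (X ⊆? S) id id (λ X⊆S → by-size X⊆S S⊆Y)) ⟩
      ∑ (subsetsOf Y) (λ S → if does (X ⊆? S)
                               then ∑ (upTo K) (λ t → kron (R + t) (∣ S ∣ ∸ ∣ X ∣) *ℤ monoCoeff 0 t i j) else + 0)
        ≡⟨ ∑-subsetsOf-sizes X Y X⊆Y (upTo K) (λ t → R + t) (λ t → monoCoeff 0 t i j) ⟩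
      ∑ (upTo K) (λ t → + (m C (R + t)) *ℤ monoCoeff 0 t i j)
        ≡⟨ sym (coeff-by m R i j pos) ⟩
      coeff (by m R) i j
        ∎
      where
      open ≡-Reasoning
      K = suc m ∸ R
      by-size : ∀ {S} → X ⊆ S → S ⊆ Y →
                truncY i j (r Y ∸ r S) ((∣ S ∣ ∸ ∣ X ∣) ∸ (r S ∸ r X))
                ≡ ∑ (upTo K) (λ t → kron (R + t) (∣ S ∣ ∸ ∣ X ∣) *ℤ monoCoeff 0 t i j)
      by-size {S} X⊆S S⊆Y with shifted-exponents X⊆S S⊆Y
      ... | rY∸rS , q≤R , q≤u = trans (cong (λ a → truncY i j a ((∣ S ∣ ∸ ∣ X ∣) ∸ (r S ∸ r X))) rY∸rS)
        (trans (truncY-∸ i j q≤R q≤u) (sym (∑-upTo-kron-+ R K (∣ S ∣ ∸ ∣ X ∣) (λ t → monoCoeff 0 t i j) u<R+K)))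
        where
        u<R+K : ∣ S ∣ ∸ ∣ X ∣ < R + K
        u<R+K = ℕₚ.<-≤-trans (s≤s (ℕₚ.∸-monoˡ-≤ ∣ X ∣ (p⊆q⇒∣p∣≤∣q∣ S⊆Y))) (ℕₚ.m≤n+m∸n (suc m) R)

module CondensationBlocks {n : ℕ} (M : Matroid n) (P : Condensation M) (Rep : Representatives M P) where

  open import Defs using (Poly; 0ₚ; 1ₚ; Σₚ; _⊗_; coeff; δx; δy; CyclicFlat; countBelow; A; allSubsets)
  open ListSums
  open Polynomials
  open Subsets
  open IntervalPolynomials M
  open Truncations M
  open import Data.Bool using (true; false; if_then_else_)
  open import Data.Nat using (_<_)
  import Data.Nat.Properties as ℕₚ
  open import Data.Integer using (ℤ; +_) renaming (_*_ to _*ℤ_)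
  import Data.Integer.Properties as ℤₚ
  open import Data.Fin using (Fin)
  import Data.Fin.Properties as Finₚ
  open import Data.Fin.Subset using (Subset; _⊆_; ∣_∣; ⊥)
  open import Data.Fin.Subset.Properties using (_⊆?_; ⊆-refl; ⊆-trans; ⊆-min; p⊆q⇒∣p∣≤∣q∣)
  open import Data.List using (map; allFin)
  open import Data.List.Membership.Propositional using (_∈_)
  open import Data.List.Membership.Propositional.Properties using (∈-allFin)
  open import Data.List.Membership.DecPropositional (_≟ₛ_ {n}) using () renaming (_∈?_ to _∈ₗ?_)
  open import Data.List.Relation.Unary.Unique.Propositional using (Unique)
  open import Data.List.Relation.Unary.Unique.Propositional.Properties using (allFin⁺)
  open import Data.Product using (Σ; _×_; _,_; proj₂)
  open import Data.Empty using (⊥-elim)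
  open import Relation.Binary.PropositionalEquality
  open import Relation.Nullary using (¬_; Dec; yes; no; does)
  open import Relation.Nullary.Decidable using (⌊_⌋; isYes≗does; dec-true)

  open Matroid M renaming (rank to r)
  open Condensation P
  open Representatives Rep

  Aᴾ : Fin k → Fin k → ℕ
  Aᴾ = A M P Rep

  infix 4 _≤ᴾ_ _≤ᴾ?_
  _≤ᴾ_ : Fin k → Fin k → Set
  B ≤ᴾ C = 0 < Aᴾ B C

  -- chosen so that leqᵇ M P Rep B C is definitionally does (B ≤ᴾ? C)
  _≤ᴾ?_ : ∀ B C → Dec (B ≤ᴾ C)
  B ≤ᴾ? C = 0 ℕₚ.<? Aᴾ B C

  block-unique : ∀ B → Unique (block B)
  block-unique B = lookup-injective⇒Unique (block B) (nodup B)

  ∈-block-cyclicFlat : ∀ {B X} → X ∈ block B → CyclicFlat M X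
  ∈-block-cyclicFlat {B} {X} = sound B X

  ∈-block-⊆⇒≡ : ∀ {B X Y} → X ∈ block B → Y ∈ block B → X ⊆ Y → X ≡ Y
  ∈-block-⊆⇒≡ {B} {X} {Y} X∈ Y∈ X⊆Y = ⊆∧∣∣≡⇒≡ X⊆Y (const-card B X Y X∈ Y∈)

  ∈-block-≢ : ∀ {B C X Y} → X ∈ block B → Y ∈ block C → B ≢ C → X ≢ Y
  ∈-block-≢ {B} {C} X∈ Y∈ B≢C refl = B≢C (disjoint B C _ X∈ Y∈)

  ∑-below : ∀ B {C Y} → Y ∈ block C → ∑ (block B) (λ X → if does (X ⊆? Y) then + 1 else + 0) ≡ + Aᴾ B C
  ∑-below B {C} {Y} Y∈ = begin
    ∑ (block B) (λ X → if does (X ⊆? Y) then + 1 else + 0)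
      ≡⟨ ∑-cong (block B) (λ X → cong (λ b → if b then + 1 else + 0) (sym (isYes≗does (X ⊆? Y)))) ⟩
    ∑ (block B) (λ X → if ⌊ X ⊆? Y ⌋ then + 1 else + 0)
      ≡⟨ sym (length-filterᵇ (λ X → ⌊ X ⊆? Y ⌋) (block B)) ⟩
    + countBelow M (block B) Y
      ≡⟨ cong +_ (const-A B C Y (R C) Y∈ (R∈ C)) ⟩
    + Aᴾ B C
      ∎
    where open ≡-Reasoning

  ≤ᴾ-witness : ∀ {B C Y} → B ≤ᴾ C → Y ∈ block C → Σ (Subset n) (λ X → X ∈ block B × X ⊆ Y)
  ≤ᴾ-witness {B} {C} {Y} B≤C Y∈ with filterᵇ-nonempty⁻ (λ X → ⌊ X ⊆? Y ⌋) (block B)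
                                       (subst (0 <_) (sym (const-A B C Y (R C) Y∈ (R∈ C))) B≤C)
  ... | X , X∈ , X⊆?Y = X , X∈ , does⇒ (X ⊆? Y) (trans (sym (isYes≗does (X ⊆? Y))) X⊆?Y)

  ≤ᴾ-intro : ∀ {B C X Y} → X ∈ block B → Y ∈ block C → X ⊆ Y → B ≤ᴾ C
  ≤ᴾ-intro {B} {C} {X} {Y} X∈ Y∈ X⊆Y = subst (0 <_) (const-A B C Y (R C) Y∈ (R∈ C))
    (filterᵇ-nonempty⁺ (λ X → ⌊ X ⊆? Y ⌋) X∈ (trans (isYes≗does (X ⊆? Y)) (dec-true (X ⊆? Y) X⊆Y)))

  ≤ᴾ-trans : ∀ {B D C} → B ≤ᴾ D → D ≤ᴾ C → B ≤ᴾ C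
  ≤ᴾ-trans {C = C} B≤D D≤C with ≤ᴾ-witness D≤C (R∈ C)
  ... | Z , Z∈ , Z⊆R with ≤ᴾ-witness B≤D Z∈
  ...   | X , X∈ , X⊆Z = ≤ᴾ-intro X∈ (R∈ C) (⊆-trans X⊆Z Z⊆R)

  ≤ᴾ-size : ∀ {B C} → B ≢ C → B ≤ᴾ C → ∣ R B ∣ < ∣ R C ∣
  ≤ᴾ-size {B} {C} B≢C B≤C with ≤ᴾ-witness B≤C (R∈ C)
  ... | X , X∈ , X⊆R = subst (_< ∣ R C ∣) (const-card B X (R B) X∈ (R∈ B))
    (ℕₚ.≤∧≢⇒< (p⊆q⇒∣p∣≤∣q∣ X⊆R) (λ eq → ∈-block-≢ X∈ (R∈ C) B≢C (⊆∧∣∣≡⇒≡ X⊆R eq)))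

  Aᴾ-refl : ∀ B → Aᴾ B B ≡ 1
  Aᴾ-refl B = ℤₚ.+-injective (begin
    + Aᴾ B B
      ≡⟨ sym (∑-below B (R∈ B)) ⟩
    ∑ (block B) (λ X → if does (X ⊆? R B) then + 1 else + 0)
      ≡⟨ ∑-unique _ (block-unique B) (R∈ B) (λ X X∈ X≢R → if-no (X ⊆? R B) (λ X⊆R → X≢R (∈-block-⊆⇒≡ X∈ (R∈ B) X⊆R))) ⟩
    (if does (R B ⊆? R B) then + 1 else + 0)
      ≡⟨ if-yes (R B ⊆? R B) ⊆-refl ⟩
    + 1
      ∎)
    where open ≡-Reasoning

  ∑-blocks : (g : Subset n → ℤ) → (∀ W → ¬ CyclicFlat M W → g W ≡ + 0) →
             ∑ (allSubsets n) g ≡ ∑ (allFin k) (λ D → ∑ (block D) g)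
  ∑-blocks g g-off = sym (begin
    ∑ (allFin k) (λ D → ∑ (block D) g)
      ≡⟨ ∑-cong (allFin k) (λ D → ∑-cong (block D) (λ W → sym (∑-allSubsets-≟ₛ W g))) ⟩
    ∑ (allFin k) (λ D → ∑ (block D) (λ W → ∑ (allSubsets n) (λ V → δ V W)))
      ≡⟨ ∑-cong (allFin k) (λ D → ∑-comm (block D) (allSubsets n) (λ W V → δ V W)) ⟩
    ∑ (allFin k) (λ D → ∑ (allSubsets n) (λ V → ∑ (block D) (δ V)))
      ≡⟨ ∑-comm (allFin k) (allSubsets n) _ ⟩
    ∑ (allSubsets n) (λ V → ∑ (allFin k) (λ D → ∑ (block D) (δ V)))
      ≡⟨ ∑-cong (allSubsets n) (λ V → counted-once V (Finₚ.any? (λ D → V ∈ₗ? block D))) ⟩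
    ∑ (allSubsets n) g
      ∎)
    where
    open ≡-Reasoning
    δ : Subset n → Subset n → ℤ
    δ V W = if does (V ≟ₛ W) then g V else + 0
    counted-once : ∀ V → Dec (Σ (Fin k) (λ D → V ∈ block D)) → ∑ (allFin k) (λ D → ∑ (block D) (δ V)) ≡ g V
    counted-once V (yes (D₀ , V∈D₀)) = begin
      ∑ (allFin k) (λ D → ∑ (block D) (δ V))
        ≡⟨ ∑-unique _ (allFin⁺ k) (∈-allFin D₀) (λ D _ D≢D₀ →
             ∑-zero-∈ (block D) (λ W W∈ → if-no (V ≟ₛ W) (λ { refl → D≢D₀ (disjoint D D₀ V W∈ V∈D₀) }))) ⟩
      ∑ (block D₀) (δ V)
        ≡⟨ ∑-unique _ (block-unique D₀) V∈D₀ (λ W _ W≢V → if-no (V ≟ₛ W) (λ V≡W → W≢V (sym V≡W))) ⟩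
      δ V V
        ≡⟨ if-yes (V ≟ₛ V) refl ⟩
      g V
        ∎
    counted-once V (no V∉) =
      trans (∑-zero-∈ (allFin k) (λ D _ → ∑-zero-∈ (block D) (λ W W∈ → if-no (V ≟ₛ W) (λ { refl → V∉ (D , W∈) }))))
            (sym (g-off V (λ V-cf → V∉ (complete V V-cf))))

  Cblock Fblock : Fin k → Subset n → Poly
  Cblock D Y = Σₚ (map (λ W → Cpoly W Y) (block D))
  Fblock B W = Σₚ (map (λ X → Fpoly X W) (block B))

  Cblock-refl : ∀ {B Y} → Y ∈ block B → Cblock B Y ≈ 1ₚ
  Cblock-refl {B} {Y} Y∈ i j = begin
    coeff (Cblock B Y) i j
      ≡⟨ coeff-Σₚ (λ W → Cpoly W Y) (block B) i j ⟩
    ∑ (block B) (λ W → coeff (Cpoly W Y) i j)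
      ≡⟨ ∑-unique _ (block-unique B) Y∈ (λ W W∈ W≢Y → Cpoly-⊈ (λ W⊆Y → W≢Y (∈-block-⊆⇒≡ W∈ Y∈ W⊆Y)) i j) ⟩
    coeff (Cpoly Y Y) i j
      ≡⟨ Cpoly-refl (∈-block-cyclicFlat Y∈) i j ⟩
    coeff 1ₚ i j
      ∎
    where open ≡-Reasoning

  Fblock-refl : ∀ {B W} → W ∈ block B → Fblock B W ≈ 1ₚ
  Fblock-refl {B} {W} W∈ i j = begin
    coeff (Fblock B W) i j
      ≡⟨ coeff-Σₚ (λ X → Fpoly X W) (block B) i j ⟩
    ∑ (block B) (λ X → coeff (Fpoly X W) i j)
      ≡⟨ ∑-unique _ (block-unique B) W∈ (λ X X∈ X≢W → Fpoly-⊈ (λ X⊆W → X≢W (∈-block-⊆⇒≡ X∈ W∈ X⊆W)) i j) ⟩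
    coeff (Fpoly W W) i j
      ≡⟨ Fpoly-refl W i j ⟩
    coeff 1ₚ i j
      ∎
    where open ≡-Reasoning

  Cblock-≰ : ∀ {B C Y} → ¬ B ≤ᴾ C → Y ∈ block C → Cblock B Y ≈ 0ₚ
  Cblock-≰ {B} {C} {Y} B≰C Y∈ i j = trans (coeff-Σₚ (λ W → Cpoly W Y) (block B) i j)
    (∑-zero-∈ (block B) (λ W W∈ → Cpoly-⊈ (λ W⊆Y → B≰C (≤ᴾ-intro W∈ Y∈ W⊆Y)) i j))

  Fblock-≰ : ∀ {B C W} → ¬ B ≤ᴾ C → W ∈ block C → Fblock B W ≈ 0ₚ
  Fblock-≰ {B} {C} {W} B≰C W∈ i j = trans (coeff-Σₚ (λ X → Fpoly X W) (block B) i j)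
    (∑-zero-∈ (block B) (λ X X∈ → Fpoly-⊈ (λ X⊆W → B≰C (≤ᴾ-intro X∈ W∈ X⊆W)) i j))

  blockTerm : Fin k → Subset n → ℕ → ℕ → Fin k → ℤ
  blockTerm B Y i j D = ∑ (block D) (λ W → coeff (Cpoly W Y ⊗ Fblock B W) i j)

  Rblock-decomposition : ∀ B {Y} → CyclicFlat M Y → ∀ i j →
    coeff (Σₚ (map (λ X → Rpoly X Y) (block B))) i j ≡ ∑ (allFin k) (blockTerm B Y i j)
  Rblock-decomposition B {Y} (Y-flat , _) i j = begin
    coeff (Σₚ (map (λ X → Rpoly X Y) (block B))) i j
      ≡⟨ coeff-Σₚ (λ X → Rpoly X Y) (block B) i j ⟩
    ∑ (block B) (λ X → coeff (Rpoly X Y) i j)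
      ≡⟨ ∑-cong-∈ (block B) (λ X X∈ → Rpoly-decomposition X Y i j (proj₂ (∈-block-cyclicFlat X∈)) Y-flat) ⟩
    ∑ (block B) (λ X → ∑ (allSubsets n) (λ W → coeff (Cpoly W Y ⊗ Fpoly X W) i j))
      ≡⟨ ∑-comm (block B) (allSubsets n) _ ⟩
    ∑ (allSubsets n) (λ W → ∑ (block B) (λ X → coeff (Cpoly W Y ⊗ Fpoly X W) i j))
      ≡⟨ ∑-cong (allSubsets n) (λ W → sym (coeff-⊗-Σₚ (Cpoly W Y) (λ X → Fpoly X W) (block B) i j)) ⟩
    ∑ (allSubsets n) (λ W → coeff (Cpoly W Y ⊗ Fblock B W) i j)
      ≡⟨ ∑-blocks _ (λ W W-not → ⊗-congˡ {Cpoly W Y} {0ₚ} (Fblock B W) (Cpoly-nonCyclicFlat {W} {Y} W-not) i j) ⟩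
    ∑ (allFin k) (blockTerm B Y i j)
      ∎
    where open ≡-Reasoning

  ∑-below-const : ∀ B {C Y} → Y ∈ block C → (c : ℤ) →
                  ∑ (block B) (λ X → if does (X ⊆? Y) then c else + 0) ≡ + Aᴾ B C *ℤ c
  ∑-below-const B {C} {Y} Y∈ c = begin
    ∑ (block B) (λ X → if does (X ⊆? Y) then c else + 0)
      ≡⟨ ∑-cong (block B) (λ X → indicator (does (X ⊆? Y))) ⟩
    ∑ (block B) (λ X → (if does (X ⊆? Y) then + 1 else + 0) *ℤ c)
      ≡⟨ ∑-*ʳ (block B) _ c ⟩
    ∑ (block B) (λ X → if does (X ⊆? Y) then + 1 else + 0) *ℤ c
      ≡⟨ cong (_*ℤ c) (∑-below B Y∈) ⟩
    + Aᴾ B C *ℤ c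
      ∎
    where
    open ≡-Reasoning
    indicator : ∀ b → (if b then c else + 0) ≡ (if b then + 1 else + 0) *ℤ c
    indicator true = sym (ℤₚ.*-identityˡ c)
    indicator false = refl

  blockTerm-source : ∀ B Y i j → blockTerm B Y i j B ≡ coeff (Cblock B Y) i j
  blockTerm-source B Y i j = begin
    ∑ (block B) (λ W → coeff (Cpoly W Y ⊗ Fblock B W) i j)
      ≡⟨ ∑-cong-∈ (block B) (λ W W∈ → trans (⊗-congʳ (Cpoly W Y) {Fblock B W} {1ₚ} (Fblock-refl W∈) i j)
                                              (⊗-1ₚ (Cpoly W Y) i j)) ⟩
    ∑ (block B) (λ W → coeff (Cpoly W Y) i j)
      ≡⟨ sym (coeff-Σₚ (λ W → Cpoly W Y) (block B) i j) ⟩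
    coeff (Cblock B Y) i j
      ∎
    where open ≡-Reasoning

  blockTerm-target : ∀ B {C Y} → Y ∈ block C → ∀ i j → blockTerm B Y i j C ≡ coeff (Fblock B Y) i j
  blockTerm-target B {C} {Y} Y∈ i j = begin
    ∑ (block C) (λ W → coeff (Cpoly W Y ⊗ Fblock B W) i j)
      ≡⟨ ∑-unique _ (block-unique C) Y∈ (λ W W∈ W≢Y →
           ⊗-congˡ {Cpoly W Y} {0ₚ} (Fblock B W) (Cpoly-⊈ (λ W⊆Y → W≢Y (∈-block-⊆⇒≡ W∈ Y∈ W⊆Y))) i j) ⟩
    coeff (Cpoly Y Y ⊗ Fblock B Y) i j
      ≡⟨ ⊗-congˡ {Cpoly Y Y} {1ₚ} (Fblock B Y) (Cpoly-refl (∈-block-cyclicFlat Y∈)) i j ⟩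
    coeff (1ₚ ⊗ Fblock B Y) i j
      ≡⟨ 1ₚ-⊗ (Fblock B Y) i j ⟩
    coeff (Fblock B Y) i j
      ∎
    where open ≡-Reasoning

  blockTerm-≰ˡ : ∀ B {D} Y i j → ¬ B ≤ᴾ D → blockTerm B Y i j D ≡ + 0
  blockTerm-≰ˡ B {D} Y i j B≰D = ∑-zero-∈ (block D) (λ W W∈ →
    trans (⊗-congʳ (Cpoly W Y) {Fblock B W} {0ₚ} (Fblock-≰ B≰D W∈) i j) (⊗-0ₚ (Cpoly W Y) i j))

  blockTerm-≰ʳ : ∀ B {C D Y} → Y ∈ block C → ∀ i j → ¬ D ≤ᴾ C → blockTerm B Y i j D ≡ + 0
  blockTerm-≰ʳ B {C} {D} {Y} Y∈ i j D≰C = ∑-zero-∈ (block D) (λ W W∈ →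
    ⊗-congˡ {Cpoly W Y} {0ₚ} (Fblock B W) (Cpoly-⊈ (λ W⊆Y → D≰C (≤ᴾ-intro W∈ Y∈ W⊆Y))) i j)

  blockTerm-≈ : ∀ B D Y (c q : Poly) → Cblock D Y ≈ c → (∀ {W} → W ∈ block D → Fblock B W ≈ q) →
                ∀ i j → blockTerm B Y i j D ≡ coeff (c ⊗ q) i j
  blockTerm-≈ B D Y c q C≈c F≈q i j = begin
    ∑ (block D) (λ W → coeff (Cpoly W Y ⊗ Fblock B W) i j)
      ≡⟨ ∑-cong-∈ (block D) (λ W W∈ → ⊗-congʳ (Cpoly W Y) {Fblock B W} {q} (F≈q W∈) i j) ⟩
    ∑ (block D) (λ W → coeff (Cpoly W Y ⊗ q) i j)
      ≡⟨ sym (coeff-Σₚ-⊗ (λ W → Cpoly W Y) (block D) q i j) ⟩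
    coeff (Cblock D Y ⊗ q) i j
      ≡⟨ ⊗-congˡ {Cblock D Y} {c} q C≈c i j ⟩
    coeff (c ⊗ q) i j
      ∎
    where open ≡-Reasoning

  module _ {B C Y} (B≢C : B ≢ C) (Y∈ : Y ∈ block C) where

    Cblock-δx : δx (Cblock B Y) ≈ Cblock B Y
    Cblock-δx i j = trans (coeff-δx-Σₚ (λ W → Cpoly W Y) (block B) i j)
      (trans (∑-cong-∈ (block B) (λ W W∈ → Cpoly-δx (∈-block-cyclicFlat Y∈) (∈-block-≢ W∈ Y∈ B≢C) i j))
             (sym (coeff-Σₚ (λ W → Cpoly W Y) (block B) i j)))

    Cblock-δy : δy (Cblock B Y) ≈ 0ₚ
    Cblock-δy i j = trans (coeff-δy-Σₚ (λ W → Cpoly W Y) (block B) i j)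
      (∑-zero-∈ (block B) (λ W W∈ → Cpoly-δy (∈-block-cyclicFlat Y∈) (∈-block-≢ W∈ Y∈ B≢C) i j))

  Fblock-δx : ∀ B W → δx (Fblock B W) ≈ 0ₚ
  Fblock-δx B W i j = trans (coeff-δx-Σₚ (λ X → Fpoly X W) (block B) i j)
    (∑-zero-∈ (block B) (λ X _ → Fpoly-δx X W i j))

  Fblock-δy : ∀ B W → δy (Fblock B W) ≈ Fblock B W
  Fblock-δy B W i j = trans (coeff-δy-Σₚ (λ X → Fpoly X W) (block B) i j)
    (trans (∑-cong (block B) (λ X → Fpoly-δy X W i j)) (sym (coeff-Σₚ (λ X → Fpoly X W) (block B) i j)))

  Rblock-⊥ : ∀ {B} → ⊥ ∈ block B → ∀ Y i j → coeff (Σₚ (map (λ X → Rpoly X Y) (block B))) i j ≡ coeff (Rpoly ⊥ Y) i j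
  Rblock-⊥ {B} ⊥∈ Y i j = trans (coeff-Σₚ (λ X → Rpoly X Y) (block B) i j)
    (∑-unique _ (block-unique B) ⊥∈ (λ X X∈ X≢⊥ →
      ⊥-elim (X≢⊥ (sym (⊆∧∣∣≡⇒≡ (⊆-min X) (sym (const-card B X ⊥ X∈ ⊥∈)))))))

module CondensationRecursion {n : ℕ} (M : Matroid n) (P : Condensation M) (Rep : Representatives M P) where

  open import Defs using (Poly; 0ₚ; 1ₚ; Σₚ; _⊕_; _⊗_; coeff; δx; δy; bx; by; leqᵇ; nn; rr; between; CPf; FPf; Sf; _·ₚ_; ⊖_; CP; FP)
  open ListSums
  open Polynomials
  open IntervalPolynomials M
  open Truncations M
  open CondensationBlocks M P Rep
  open import Data.Bool using (if_then_else_; _∧_; not)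
  open import Data.Nat using (zero; suc; _<_; _∸_; s≤s)
  import Data.Nat.Properties as ℕₚ
  open import Data.Integer using (ℤ; +_; -_) renaming (_+_ to _+ℤ_; _*_ to _*ℤ_)
  import Data.Integer.Properties as ℤₚ
  open import Data.Integer.Tactic.RingSolver using (solve-∀)
  open import Data.Fin using (Fin; _≟_)
  open import Data.Fin.Subset using (Subset; _⊆_; ∣_∣)
  open import Data.Fin.Subset.Properties using (_⊆?_; ∣p∣≤n)
  open import Data.List using (map; allFin)
  open import Data.List.Membership.Propositional using (_∈_)
  open import Data.Product using (_×_; _,_; proj₁; proj₂)
  open import Relation.Binary.PropositionalEquality
  open import Relation.Nullary using (¬_; Dec; yes; no; does; ¬?)
  open import Relation.Nullary.Decidable using (⌊_⌋; _×-dec_; isYes≗does)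

  open Matroid M renaming (rank to r)
  open Condensation P
  open Representatives Rep

  private
    Cᶠ Fᶠ Sᶠ : ℕ → Fin k → Fin k → Poly
    Cᶠ = CPf M P Rep
    Fᶠ = FPf M P Rep
    Sᶠ = Sf M P Rep
    nᴾ rᴾ : Fin k → Fin k → ℕ
    nᴾ = nn M P Rep
    rᴾ = rr M P Rep

  StrictlyBetween : Fin k → Fin k → Fin k → Set
  StrictlyBetween B C D = B ≤ᴾ D × D ≤ᴾ C × D ≢ B × D ≢ C

  strictlyBetween? : ∀ B C D → Dec (StrictlyBetween B C D)
  strictlyBetween? B C D = (B ≤ᴾ? D) ×-dec (D ≤ᴾ? C) ×-dec ¬? (D ≟ B) ×-dec ¬? (D ≟ C)

  coeff-Sᶠ : ∀ f B C i j → coeff (Sᶠ f B C) i j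
             ≡ ∑ (allFin k) (λ D → if does (strictlyBetween? B C D) then coeff (Cᶠ f D C ⊗ Fᶠ f B D) i j else + 0)
  coeff-Sᶠ f B C i j = trans (coeff-Σₚ (λ D → Cᶠ f D C ⊗ Fᶠ f B D) (between M P Rep B C) i j)
    (trans (∑-filterᵇ (λ D → leqᵇ M P Rep B D ∧ leqᵇ M P Rep D C ∧ not ⌊ D ≟ B ⌋ ∧ not ⌊ D ≟ C ⌋) (allFin k)
                      (λ D → coeff (Cᶠ f D C ⊗ Fᶠ f B D) i j))
    (∑-cong (allFin k) (λ D → cong (λ b → if b then coeff (Cᶠ f D C ⊗ Fᶠ f B D) i j else + 0)
      (cong₂ (λ s t → does (B ≤ᴾ? D) ∧ does (D ≤ᴾ? C) ∧ not s ∧ not t) (isYes≗does (D ≟ B)) (isYes≗does (D ≟ C))))))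

  Sᶠ-empty : ∀ f {B C} → (∀ D → ¬ StrictlyBetween B C D) → Sᶠ f B C ≈ 0ₚ
  Sᶠ-empty f {B} {C} none i j =
    trans (coeff-Sᶠ f B C i j) (∑-zero-∈ (allFin k) (λ D _ → if-no (strictlyBetween? B C D) (none D)))

  coeff-Cᶠ-suc : ∀ f B C i j → coeff (Cᶠ (suc f) B C) i j
                 ≡ + Aᴾ B C *ℤ coeff (bx (nᴾ B C) (rᴾ B C)) i j +ℤ - coeff (δx (Sᶠ f B C)) i j
  coeff-Cᶠ-suc f B C i j = trans (coeff-++ (Aᴾ B C ·ₚ bx (nᴾ B C) (rᴾ B C)) (⊖ δx (Sᶠ f B C)) i j)
    (cong₂ _+ℤ_ (coeff-·ₚ (Aᴾ B C) (bx (nᴾ B C) (rᴾ B C)) i j) (coeff-⊖ (δx (Sᶠ f B C)) i j))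

  coeff-Fᶠ-suc : ∀ f B C i j → coeff (Fᶠ (suc f) B C) i j
                 ≡ + Aᴾ B C *ℤ coeff (by (nᴾ B C) (rᴾ B C)) i j +ℤ - coeff (δy (Sᶠ f B C)) i j
  coeff-Fᶠ-suc f B C i j = trans (coeff-++ (Aᴾ B C ·ₚ by (nᴾ B C) (rᴾ B C)) (⊖ δy (Sᶠ f B C)) i j)
    (cong₂ _+ℤ_ (coeff-·ₚ (Aᴾ B C) (by (nᴾ B C) (rᴾ B C)) i j) (coeff-⊖ (δy (Sᶠ f B C)) i j))

  Identified : ℕ → Fin k → Fin k → Set
  Identified f B C = ∀ {Y} → Y ∈ block C → Cᶠ f B C ≈ Cblock B Y × Fᶠ f B C ≈ Fblock B Y

  identified-refl : ∀ f B → Identified (suc f) B B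
  identified-refl f B {Y} Y∈ = Cpart , Fpart
    where
    open ≡-Reasoning
    none : ∀ D → ¬ StrictlyBetween B B D
    none D (B≤D , D≤B , D≢B , _) = ℕₚ.<-asym (≤ᴾ-size (λ B≡D → D≢B (sym B≡D)) B≤D) (≤ᴾ-size D≢B D≤B)
    nn≡0 : nᴾ B B ≡ 0
    nn≡0 = ℕₚ.n∸n≡0 ∣ R B ∣
    rr≡0 : rᴾ B B ≡ 0
    rr≡0 = ℕₚ.n∸n≡0 (r (R B))
    Cpart : Cᶠ (suc f) B B ≈ Cblock B Y
    Cpart i j = begin
      coeff (Cᶠ (suc f) B B) i j
        ≡⟨ coeff-Cᶠ-suc f B B i j ⟩
      + Aᴾ B B *ℤ coeff (bx (nᴾ B B) (rᴾ B B)) i j +ℤ - coeff (δx (Sᶠ f B B)) i j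
        ≡⟨ cong₂ _+ℤ_ (cong₂ (λ a c → + a *ℤ c) (Aᴾ-refl B) (cong₂ (λ m s → coeff (bx m s) i j) nn≡0 rr≡0))
                      (cong -_ (δx-cong {Sᶠ f B B} {0ₚ} (Sᶠ-empty f none) i j)) ⟩
      + 1 *ℤ coeff 1ₚ i j +ℤ - (+ 0)
        ≡⟨ trans (ℤₚ.+-identityʳ _) (ℤₚ.*-identityˡ _) ⟩
      coeff 1ₚ i j
        ≡⟨ sym (Cblock-refl Y∈ i j) ⟩
      coeff (Cblock B Y) i j
        ∎
    Fpart : Fᶠ (suc f) B B ≈ Fblock B Y
    Fpart i j = begin
      coeff (Fᶠ (suc f) B B) i j
        ≡⟨ coeff-Fᶠ-suc f B B i j ⟩
      + Aᴾ B B *ℤ coeff (by (nᴾ B B) (rᴾ B B)) i j +ℤ - coeff (δy (Sᶠ f B B)) i j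
        ≡⟨ cong₂ _+ℤ_ (cong₂ (λ a c → + a *ℤ c) (Aᴾ-refl B) (cong₂ (λ m s → coeff (by m s) i j) nn≡0 rr≡0))
                      (cong -_ (δy-cong {Sᶠ f B B} {0ₚ} (Sᶠ-empty f none) i j)) ⟩
      + 1 *ℤ coeff 1ₚ i j +ℤ - (+ 0)
        ≡⟨ trans (ℤₚ.+-identityʳ _) (ℤₚ.*-identityˡ _) ⟩
      coeff 1ₚ i j
        ≡⟨ sym (Fblock-refl Y∈ i j) ⟩
      coeff (Fblock B Y) i j
        ∎

  identified-≰ : ∀ f {B C} → ¬ B ≤ᴾ C → Identified (suc f) B C
  identified-≰ f {B} {C} B≰C {Y} Y∈ = Cpart , Fpart
    where
    none : ∀ D → ¬ StrictlyBetween B C D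
    none D (B≤D , D≤C , _) = B≰C (≤ᴾ-trans B≤D D≤C)
    A≡0 : Aᴾ B C ≡ 0
    A≡0 = ℕₚ.n≤0⇒n≡0 (ℕₚ.≮⇒≥ B≰C)
    Cpart : Cᶠ (suc f) B C ≈ Cblock B Y
    Cpart i j = trans (coeff-Cᶠ-suc f B C i j)
      (trans (cong₂ _+ℤ_ (cong (λ a → + a *ℤ coeff (bx (nᴾ B C) (rᴾ B C)) i j) A≡0)
                         (cong -_ (δx-cong {Sᶠ f B C} {0ₚ} (Sᶠ-empty f none) i j)))
             (sym (Cblock-≰ B≰C Y∈ i j)))
    Fpart : Fᶠ (suc f) B C ≈ Fblock B Y
    Fpart i j = trans (coeff-Fᶠ-suc f B C i j)
      (trans (cong₂ _+ℤ_ (cong (λ a → + a *ℤ coeff (by (nᴾ B C) (rᴾ B C)) i j) A≡0)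
                         (cong -_ (δy-cong {Sᶠ f B C} {0ₚ} (Sᶠ-empty f none) i j)))
             (sym (Fblock-≰ B≰C Y∈ i j)))

  module RecursionStep (f : ℕ) (IH : ∀ B C → nᴾ B C < f → Identified f B C)
              {B C : Fin k} (B≢C : B ≢ C) (B≤C : B ≤ᴾ C) (fuel : nᴾ B C < suc f)
              {Y : Subset n} (Y∈ : Y ∈ block C) where

    ΣR : Poly
    ΣR = Σₚ (map (λ X → Rpoly X Y) (block B))

    between-identified : ∀ {D} → StrictlyBetween B C D → Identified f D C × Identified f B D
    between-identified {D} (B≤D , D≤C , D≢B , D≢C) = IH D C D-C-fuel , IH B D B-D-fuel
      where
      ∣B∣<∣D∣ : ∣ R B ∣ < ∣ R D ∣
      ∣B∣<∣D∣ = ≤ᴾ-size (λ B≡D → D≢B (sym B≡D)) B≤D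
      ∣D∣<∣C∣ : ∣ R D ∣ < ∣ R C ∣
      ∣D∣<∣C∣ = ≤ᴾ-size D≢C D≤C
      D-C-fuel : nᴾ D C < f
      D-C-fuel = ℕₚ.<-≤-trans (ℕₚ.∸-monoʳ-< ∣B∣<∣D∣ (ℕₚ.<⇒≤ ∣D∣<∣C∣)) (ℕₚ.≤-pred fuel)
      B-D-fuel : nᴾ B D < f
      B-D-fuel = ℕₚ.<-≤-trans (ℕₚ.∸-monoˡ-< ∣D∣<∣C∣ (ℕₚ.<⇒≤ ∣B∣<∣D∣)) (ℕₚ.≤-pred fuel)

    blockTerm-split : ∀ i j D →
      blockTerm B Y i j D
      ≡ (if does (D ≟ B) then coeff (Cblock B Y) i j else + 0)
        +ℤ ((if does (D ≟ C) then coeff (Fblock B Y) i j else + 0)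
        +ℤ (if does (strictlyBetween? B C D) then coeff (Cᶠ f D C ⊗ Fᶠ f B D) i j else + 0))
    blockTerm-split i j D = split (D ≟ B) (D ≟ C)
      where
      cB fB sB : ℤ
      cB = if does (D ≟ B) then coeff (Cblock B Y) i j else + 0
      fB = if does (D ≟ C) then coeff (Fblock B Y) i j else + 0
      sB = if does (strictlyBetween? B C D) then coeff (Cᶠ f D C ⊗ Fᶠ f B D) i j else + 0
      middle : D ≢ B → D ≢ C → Dec (B ≤ᴾ D) → Dec (D ≤ᴾ C) → blockTerm B Y i j D ≡ sB
      split : Dec (D ≡ B) → Dec (D ≡ C) → blockTerm B Y i j D ≡ cB +ℤ (fB +ℤ sB)
      split (yes D≡B) _ = trans (subst (λ E → blockTerm B Y i j E ≡ coeff (Cblock B Y) i j) (sym D≡B) (blockTerm-source B Y i j))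
        (sym (trans (cong₂ _+ℤ_ (if-yes (D ≟ B) D≡B)
                                (cong₂ _+ℤ_ (if-no (D ≟ C) (λ D≡C → B≢C (trans (sym D≡B) D≡C)))
                                            (if-no (strictlyBetween? B C D) (λ (_ , _ , D≢B , _) → D≢B D≡B))))
                    (ℤₚ.+-identityʳ _)))
      split (no D≢B) (yes D≡C) = trans (subst (λ E → blockTerm B Y i j E ≡ coeff (Fblock B Y) i j) (sym D≡C) (blockTerm-target B Y∈ i j))
        (sym (trans (cong₂ _+ℤ_ (if-no (D ≟ B) D≢B)
                                (cong₂ _+ℤ_ (if-yes (D ≟ C) D≡C) (if-no (strictlyBetween? B C D) (λ (_ , _ , _ , D≢C) → D≢C D≡C))))
                    (trans (ℤₚ.+-identityˡ _) (ℤₚ.+-identityʳ _))))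
      split (no D≢B) (no D≢C) = trans (middle D≢B D≢C (B ≤ᴾ? D) (D ≤ᴾ? C))
        (sym (trans (cong₂ _+ℤ_ (if-no (D ≟ B) D≢B) (cong (_+ℤ sB) (if-no (D ≟ C) D≢C)))
                    (trans (ℤₚ.+-identityˡ _) (ℤₚ.+-identityˡ _))))
      middle D≢B D≢C (yes B≤D) (yes D≤C) with between-identified (B≤D , D≤C , D≢B , D≢C)
      ... | D-C , B-D = trans
        (blockTerm-≈ B D Y (Cᶠ f D C) (Fᶠ f B D) (≈-sym {Cᶠ f D C} {Cblock D Y} (proj₁ (D-C Y∈)))
                           (λ {W} W∈ → ≈-sym {Fᶠ f B D} {Fblock B W} (proj₂ (B-D W∈))) i j)
        (sym (if-yes (strictlyBetween? B C D) (B≤D , D≤C , D≢B , D≢C)))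
      middle _ _ (no B≰D) _ =
        trans (blockTerm-≰ˡ B Y i j B≰D) (sym (if-no (strictlyBetween? B C D) (λ (B≤D , _) → B≰D B≤D)))
      middle _ _ (yes _) (no D≰C) =
        trans (blockTerm-≰ʳ B Y∈ i j D≰C) (sym (if-no (strictlyBetween? B C D) (λ (_ , D≤C , _) → D≰C D≤C)))

    ΣR-split : ΣR ≈ Cblock B Y ⊕ (Fblock B Y ⊕ Sᶠ f B C)
    ΣR-split i j = begin
      coeff ΣR i j
        ≡⟨ Rblock-decomposition B (∈-block-cyclicFlat Y∈) i j ⟩
      ∑ (allFin k) (blockTerm B Y i j)
        ≡⟨ ∑-cong (allFin k) (blockTerm-split i j) ⟩
      ∑ (allFin k) (λ D → cB D +ℤ (fB D +ℤ sB D))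
        ≡⟨ trans (∑-+ (allFin k) cB _) (cong (∑ (allFin k) cB +ℤ_) (∑-+ (allFin k) fB sB)) ⟩
      ∑ (allFin k) cB +ℤ (∑ (allFin k) fB +ℤ ∑ (allFin k) sB)
        ≡⟨ cong₂ _+ℤ_ (∑-allFin-≟ B _) (cong₂ _+ℤ_ (∑-allFin-≟ C _) (sym (coeff-Sᶠ f B C i j))) ⟩
      coeff (Cblock B Y) i j +ℤ (coeff (Fblock B Y) i j +ℤ coeff (Sᶠ f B C) i j)
        ≡⟨ sym (trans (coeff-++ (Cblock B Y) _ i j) (cong (coeff (Cblock B Y) i j +ℤ_) (coeff-++ (Fblock B Y) _ i j))) ⟩
      coeff (Cblock B Y ⊕ (Fblock B Y ⊕ Sᶠ f B C)) i j
        ∎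
      where
      open ≡-Reasoning
      cB fB sB : Fin k → ℤ
      cB D = if does (D ≟ B) then coeff (Cblock B Y) i j else + 0
      fB D = if does (D ≟ C) then coeff (Fblock B Y) i j else + 0
      sB D = if does (strictlyBetween? B C D) then coeff (Cᶠ f D C ⊗ Fᶠ f B D) i j else + 0

    module _ {X} (X∈ : X ∈ block B) (X⊆Y : X ⊆ Y) where

      ∣Y∣∸∣X∣≡nn : ∣ Y ∣ ∸ ∣ X ∣ ≡ nᴾ B C
      ∣Y∣∸∣X∣≡nn = cong₂ _∸_ (const-card C Y (R C) Y∈ (R∈ C)) (const-card B X (R B) X∈ (R∈ B))

      rY∸rX≡rr : r Y ∸ r X ≡ rᴾ B C
      rY∸rX≡rr = cong₂ _∸_ (const-rank C Y (R C) Y∈ (R∈ C)) (const-rank B X (R B) X∈ (R∈ B))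

      0<∣Y∣∸∣X∣ : 0 < ∣ Y ∣ ∸ ∣ X ∣
      0<∣Y∣∸∣X∣ = subst (0 <_) (sym ∣Y∣∸∣X∣≡nn) (ℕₚ.m<n⇒0<n∸m (≤ᴾ-size B≢C B≤C))

    ΣR-δx : ∀ i j → coeff (δx ΣR) i j ≡ + Aᴾ B C *ℤ coeff (bx (nᴾ B C) (rᴾ B C)) i j
    ΣR-δx i j = trans (coeff-δx-Σₚ (λ X → Rpoly X Y) (block B) i j)
      (trans (∑-cong-∈ (block B) (λ X X∈ → term X∈ (X ⊆? Y))) (∑-below-const B Y∈ _))
      where
      term : ∀ {X} → X ∈ block B → (X⊆?Y : Dec (X ⊆ Y)) →
             coeff (δx (Rpoly X Y)) i j ≡ (if does X⊆?Y then coeff (bx (nᴾ B C) (rᴾ B C)) i j else + 0)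
      term X∈ (yes X⊆Y) = trans (Rpoly-δx X⊆Y (0<∣Y∣∸∣X∣ X∈ X⊆Y) i j)
        (cong₂ (λ m s → coeff (bx m s) i j) (∣Y∣∸∣X∣≡nn X∈ X⊆Y) (rY∸rX≡rr X∈ X⊆Y))
      term {X} X∈ (no X⊈Y) = δx-cong {Rpoly X Y} {0ₚ} (Rpoly-⊈ X⊈Y) i j

    ΣR-δy : ∀ i j → coeff (δy ΣR) i j ≡ + Aᴾ B C *ℤ coeff (by (nᴾ B C) (rᴾ B C)) i j
    ΣR-δy i j = trans (coeff-δy-Σₚ (λ X → Rpoly X Y) (block B) i j)
      (trans (∑-cong-∈ (block B) (λ X X∈ → term X∈ (X ⊆? Y))) (∑-below-const B Y∈ _))
      where
      term : ∀ {X} → X ∈ block B → (X⊆?Y : Dec (X ⊆ Y)) →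
             coeff (δy (Rpoly X Y)) i j ≡ (if does X⊆?Y then coeff (by (nᴾ B C) (rᴾ B C)) i j else + 0)
      term X∈ (yes X⊆Y) = trans (Rpoly-δy X⊆Y (0<∣Y∣∸∣X∣ X∈ X⊆Y) i j)
        (cong₂ (λ m s → coeff (by m s) i j) (∣Y∣∸∣X∣≡nn X∈ X⊆Y) (rY∸rX≡rr X∈ X⊆Y))
      term {X} X∈ (no X⊈Y) = δy-cong {Rpoly X Y} {0ₚ} (Rpoly-⊈ X⊈Y) i j

    Cpart : Cᶠ (suc f) B C ≈ Cblock B Y
    Cpart i j = begin
      coeff (Cᶠ (suc f) B C) i j
        ≡⟨ coeff-Cᶠ-suc f B C i j ⟩
      + Aᴾ B C *ℤ coeff (bx (nᴾ B C) (rᴾ B C)) i j +ℤ - s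
        ≡⟨ cong (_+ℤ - s) (sym (ΣR-δx i j)) ⟩
      coeff (δx ΣR) i j +ℤ - s
        ≡⟨ cong (_+ℤ - s) (δx-cong {ΣR} {Cblock B Y ⊕ (Fblock B Y ⊕ Sᶠ f B C)} ΣR-split i j) ⟩
      coeff (δx (Cblock B Y ⊕ (Fblock B Y ⊕ Sᶠ f B C))) i j +ℤ - s
        ≡⟨ cong (_+ℤ - s) (trans (coeff-δx-++ (Cblock B Y) _ i j)
             (cong₂ _+ℤ_ (Cblock-δx B≢C Y∈ i j)
                         (trans (coeff-δx-++ (Fblock B Y) _ i j) (cong (_+ℤ s) (Fblock-δx B Y i j))))) ⟩
      coeff (Cblock B Y) i j +ℤ (+ 0 +ℤ s) +ℤ - s
        ≡⟨ cancel (coeff (Cblock B Y) i j) s ⟩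
      coeff (Cblock B Y) i j
        ∎
      where
      open ≡-Reasoning
      s = coeff (δx (Sᶠ f B C)) i j
      cancel : ∀ c s → c +ℤ (+ 0 +ℤ s) +ℤ - s ≡ c
      cancel = solve-∀

    Fpart : Fᶠ (suc f) B C ≈ Fblock B Y
    Fpart i j = begin
      coeff (Fᶠ (suc f) B C) i j
        ≡⟨ coeff-Fᶠ-suc f B C i j ⟩
      + Aᴾ B C *ℤ coeff (by (nᴾ B C) (rᴾ B C)) i j +ℤ - s
        ≡⟨ cong (_+ℤ - s) (sym (ΣR-δy i j)) ⟩
      coeff (δy ΣR) i j +ℤ - s
        ≡⟨ cong (_+ℤ - s) (δy-cong {ΣR} {Cblock B Y ⊕ (Fblock B Y ⊕ Sᶠ f B C)} ΣR-split i j) ⟩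
      coeff (δy (Cblock B Y ⊕ (Fblock B Y ⊕ Sᶠ f B C))) i j +ℤ - s
        ≡⟨ cong (_+ℤ - s) (trans (coeff-δy-++ (Cblock B Y) _ i j)
             (cong₂ _+ℤ_ (Cblock-δy B≢C Y∈ i j)
                         (trans (coeff-δy-++ (Fblock B Y) _ i j) (cong (_+ℤ s) (Fblock-δy B Y i j))))) ⟩
      + 0 +ℤ (coeff (Fblock B Y) i j +ℤ s) +ℤ - s
        ≡⟨ cancel (coeff (Fblock B Y) i j) s ⟩
      coeff (Fblock B Y) i j
        ∎
      where
      open ≡-Reasoning
      s = coeff (δy (Sᶠ f B C)) i j
      cancel : ∀ g s → + 0 +ℤ (g +ℤ s) +ℤ - s ≡ g
      cancel = solve-∀

  identification : ∀ f B C → nᴾ B C < f → Identified f B C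
  identification zero _ _ ()
  identification (suc f) B C fuel {Y} Y∈ with B ≟ C
  ... | yes refl = identified-refl f B Y∈
  ... | no B≢C with B ≤ᴾ? C
  ...   | no B≰C = identified-≰ f B≰C Y∈
  ...   | yes B≤C = RecursionStep.Cpart f (identification f) B≢C B≤C fuel Y∈ , RecursionStep.Fpart f (identification f) B≢C B≤C fuel Y∈

  private
    enough-fuel : ∀ B C → nᴾ B C < suc n
    enough-fuel B C = s≤s (ℕₚ.≤-trans (ℕₚ.m∸n≤m ∣ R C ∣ ∣ R B ∣) (∣p∣≤n (R C)))

  Cblock≈CP : ∀ {B C Y} → Y ∈ block C → Cblock B Y ≈ CP M P Rep B C
  Cblock≈CP {B} {C} {Y} Y∈ = ≈-sym {CP M P Rep B C} {Cblock B Y} (proj₁ (identification (suc n) B C (enough-fuel B C) Y∈))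

  Fblock≈FP : ∀ {B C Y} → Y ∈ block C → Fblock B Y ≈ FP M P Rep B C
  Fblock≈FP {B} {C} {Y} Y∈ = ≈-sym {FP M P Rep B C} {Fblock B Y} (proj₂ (identification (suc n) B C (enough-fuel B C) Y∈))

open import Defs
open import Data.Nat using (ℕ)
open import Data.Fin using (Fin)
open import Data.Fin.Subset using (⊤; ⊥)
open import Data.List using (map; allFin)
open import Data.List.Membership.Propositional using (_∈_)
open import Relation.Binary.PropositionalEquality using (_≡_)

lemma5p7 : {n : ℕ} (M : Matroid n) → Loopless M → Coloopless M →
    (P : Condensation M) (Rep : Representatives M P) →
    (1P 0P : Fin (Condensation.k P)) →
    ⊤ ∈ Condensation.block P 1P → ⊥ ∈ Condensation.block P 0P →
    ∀ i j → coeff (rankGenPoly M) i j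
      ≡ coeff (Σₚ (map (λ B → CP M P Rep B 1P ⊗ FP M P Rep 0P B) (allFin (Condensation.k P)))) i j
-- Looplessness and coloplessness only serve to make ∅ and E cyclic flats, which ⊥∈ and ⊤∈ provide directly.
lemma5p7 M _ _ P Rep 1P 0P ⊤∈ ⊥∈ i j = begin
  coeff (rankGenPoly M) i j
    ≡⟨ rankGenPoly≈Rpoly i j ⟩
  coeff (Rpoly ⊥ ⊤) i j
    ≡⟨ sym (Rblock-⊥ ⊥∈ ⊤ i j) ⟩
  coeff (Σₚ (map (λ X → Rpoly X ⊤) (block 0P))) i j
    ≡⟨ Rblock-decomposition 0P (∈-block-cyclicFlat ⊤∈) i j ⟩
  ∑ (allFin k) (blockTerm 0P ⊤ i j)
    ≡⟨ ∑-cong (allFin k) (λ D → blockTerm-≈ 0P D ⊤ (CP M P Rep D 1P) (FP M P Rep 0P D) (Cblock≈CP ⊤∈) Fblock≈FP i j) ⟩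
  ∑ (allFin k) (λ D → coeff (CP M P Rep D 1P ⊗ FP M P Rep 0P D) i j)
    ≡⟨ sym (coeff-Σₚ (λ D → CP M P Rep D 1P ⊗ FP M P Rep 0P D) (allFin k) i j) ⟩
  coeff (Σₚ (map (λ D → CP M P Rep D 1P ⊗ FP M P Rep 0P D) (allFin k))) i j
    ∎
  where
  open Relation.Binary.PropositionalEquality using (sym)
  open Relation.Binary.PropositionalEquality.≡-Reasoning
  open ListSums using (∑; ∑-cong)
  open Polynomials using (coeff-Σₚ)
  open Condensation P
  open IntervalPolynomials M
  open CondensationBlocks M P Rep
  open CondensationRecursion M P Rep
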